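{- For all integers $n\ge 0$ and $r,k,i,j\ge 1$, the following congruences hold: \begin{align*} \bar{a}_{r,2^k}(2n+1)&\equiv0\pmod {2^{k+1}},\\ \bar{a}_{r,2^ki+2^{k-1}}(2n+1)&\equiv0\pmod {2^{k}},\\ \bar{a}_{2^{k+1}j+2^k-1,\, 2^ki+1}(4n+2)&\equiv 0\pmod {2^{k+1}},\\ \bar{a}_{2^{k+1}j+2^k,\, 2^ki}(4n+2)&\equiv 0\pmod {2^{k+1}},\\ \bar{a}_{2^{k+1}j+2^k-1,\, 2^ki+1}(4n+3)&\equiv 0\pmod {2^{k+2}},\\ \bar{a}_{2^{k+1}j+2^k,\, 2^ki}(4n+3)&\equiv 0\pmod {2^{k+2}},\\ \bar{a}_{2^{k+1}j+2^k,\, 2^ki}(8n+4)&\equiv 0 \pmod {2^{k+1}},\\ \bar{a}_{2^{k+1}j+2^k-1,\, 2^ki+1}(8n+5)&\equiv 0 \pmod {2^{k+2}}. \end{align*}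
   Context: For $m\ge1$ let $f_m:=\prod_{k=1}^{\infty}(1-q^{mk})$. For integers $r,s\ge1$, $\bar{a}_{r,s}(n)$ denotes the number of overpartitions of $n$ (partitions in which the first occurrence of each part size may be overlined) wherein each even part may appear in one of $r$ colors and each odd part in one of $s$ colors; its generating function is \[ \sum_{n=0}^{\infty}\bar{a}_{r,s}(n)q^n=\frac{f_2^{3s-2r}}{f_1^{2s}f_4^{s-r}}. \] -}

module Defs where

open import Data.Nat using (ℕ; zero; suc; _+_; _*_; _∸_; _%_; _≡ᵇ_; _≤ᵇ_)
open import Data.Bool using (if_then_else_)
open import Data.List using (map; upTo)
open import Data.Nat.ListAction using (sum)
open import Function using (id; _∘_)

-- Formal power series over ℕ, represented by their coefficient sequence.
Series : Set
Series = ℕ → ℕ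

one : Series
one zero    = 1
one (suc _) = 0

-- Multiplication by (1 + q^m).
mulPlus : ℕ → Series → Series
mulPlus m f n = f n + (if m ≤ᵇ n then f (n ∸ m) else 0)

-- Multiplication by 1/(1 - q^m) = Σ_t q^(m t), for m ≥ 1
-- (coefficient n collects t = 0 .. n, enough since m ≥ 1).
divMinus : ℕ → Series → Series
divMinus m f n =
  sum (map (λ t → if m * t ≤ᵇ n then f (n ∸ m * t) else 0) (upTo (suc n)))

iter : ℕ → (Series → Series) → Series → Series
iter zero    h = id
iter (suc c) h = h ∘ iter c h

colours : ℕ → ℕ → ℕ → ℕ
colours r s m = if m % 2 ≡ᵇ 0 then r else s

-- Multiply by ((1 + q^m)/(1 - q^m))^(colours r s m): the generating
-- function of the (coloured, possibly overlined) parts of size m.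
factor : ℕ → ℕ → ℕ → Series → Series
factor r s m = iter (colours r s m) (λ g → divMinus m (mulPlus m g))

prodUpTo : ℕ → ℕ → ℕ → Series
prodUpTo r s zero    = one
prodUpTo r s (suc N) = factor r s (suc N) (prodUpTo r s N)

-- ā_{r,s}(n): coefficient of q^n in ∏_{m≥1} ((1+q^m)/(1-q^m))^{c(m)}
--   = f_2^{3s-2r} / (f_1^{2s} f_4^{s-r});
-- factors with m > n do not affect the coefficient of q^n.
abar : ℕ → ℕ → ℕ → ℕ
abar r s n = prodUpTo r s n n

-- With L m = (1 + q^m)/(1 - q^m), the generating function of ā_{r,s} is
-- ∏_{m odd} (L m)^s · ∏_{m even} (L m)^r.  Gauss's finite form of the Jacobi
-- triple product (via Gaussian polynomials in q²) together with Euler's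
-- odd/distinct identity gives ∏_{m odd} L m = θ · E, where θ = Σ_{j∈ℤ} q^{j²}
-- and E = ∏_{m even} L m, so ā_{r,s}(T) is the coefficient of q^T in
-- θ^s E^{s+r}.  Both θ and E have the form 1 + 2A, E contains only even powers
-- of q, θ - 1 only square powers, and (1 + 2A)^(2^k) = 1 + 2^(k+1) A′ with
-- A′ ≡ A (mod 2) at odd exponents.  Each congruence is read off from the
-- coefficient at an odd exponent or at a non-square, where θ vanishes.
-- The product identities are proved for finite products, which agree with
-- the infinite ones below the relevant degree.

module Submission where

open import Defs
open import Data.Nat using (ℕ; _+_; _*_; _∸_; _^_; _≤_)
open import Data.Nat.Divisibility using (_∣_)
open import Data.Product using (_×_)

open import Algebra.Bundles using (CommutativeRing)
open import Algebra.Structures using (IsCommutativeRing)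
import Algebra.Solver.Ring
open import Algebra.Solver.Ring.AlmostCommutativeRing using (fromCommutativeRing; _-Raw-AlmostCommutative⟶_)
open import Data.Bool using (Bool; true; false; if_then_else_; not)
open import Data.Bool.Properties using (T-≡; ¬-not; not-¬; not-involutive)
open import Data.Empty using (⊥-elim)
open import Data.Integer as ℤ using (ℤ; +_)
open import Data.Integer.Divisibility.Signed as ℤ∣
  using (∣m∣n⇒∣m+n; ∣n⇒∣m*n; ∣m⇒∣m*n; *-monoʳ-∣; ∣⇒∣ᵤ) renaming (_∣_ to _∣ℤ_)
import Data.Integer.Properties as ℤₚ
open import Data.Integer.Tactic.RingSolver using () renaming (solve-∀ to solve-ℤ)
open import Data.List using (applyUpTo)
open import Data.List.Properties using (map-upTo; applyUpTo-∷ʳ)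
open import Data.Maybe using (Maybe; just; nothing)
open import Data.Nat using (zero; suc; _<_; z≤n; s≤s; _≤ᵇ_; _%_; _≡ᵇ_; NonZero)
open import Data.Nat.DivMod using (%-distribˡ-*; [m+kn]%n≡m%n; m<n⇒m%n≡m; m%n<n)
open import Data.Nat.Divisibility using (divides)
open import Data.Nat.Induction using (<-rec)
open import Data.Nat.ListAction using (sum)
open import Data.Nat.ListAction.Properties using (sum-++)
import Data.Nat.Properties as ℕₚ
open import Data.Nat.Tactic.RingSolver using () renaming (solve-∀ to solve-ℕ)
open import Data.Product using (_,_; Σ; proj₁; proj₂)
open import Data.Sum using (inj₁; inj₂)
open import Function using (_∘_)
open import Function.Bundles using (Equivalence)
open import Relation.Binary.Definitions using (Tri; tri<; tri≈; tri>)
open import Relation.Binary.PropositionalEquality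
  using (_≡_; _≢_; refl; sym; trans; cong; cong₂; subst; subst₂; module ≡-Reasoning)
open import Relation.Binary.Bundles using (Setoid)
import Relation.Binary.Reasoning.Setoid as SetoidReasoning
open import Relation.Nullary using (yes; no)

ℤ[[q]] : Set
ℤ[[q]] = ℕ → ℤ

infix 4 _≈_
_≈_ : ℤ[[q]] → ℤ[[q]] → Set
f ≈ g = ∀ n → f n ≡ g n

tail : ℤ[[q]] → ℤ[[q]]
tail f n = f (suc n)

const : ℤ → ℤ[[q]]
const c zero    = c
const c (suc _) = + 0

0ₛ 1ₛ : ℤ[[q]]
0ₛ = const (+ 0)
1ₛ = const (+ 1)

infixl 6 _⊕_
infixl 7 _⊛_ _·_
infix  8 ⊝_

_⊕_ : ℤ[[q]] → ℤ[[q]] → ℤ[[q]]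
(f ⊕ g) n = f n ℤ.+ g n

⊝_ : ℤ[[q]] → ℤ[[q]]
(⊝ f) n = ℤ.- f n

_·_ : ℤ → ℤ[[q]] → ℤ[[q]]
(c · f) n = c ℤ.* f n

_⊛_ : ℤ[[q]] → ℤ[[q]] → ℤ[[q]]
(f ⊛ g) zero    = f 0 ℤ.* g 0
(f ⊛ g) (suc n) = f 0 ℤ.* g (suc n) ℤ.+ (tail f ⊛ g) n

≈-refl : ∀ {f} → f ≈ f
≈-refl _ = refl

≈-sym : ∀ {f g} → f ≈ g → g ≈ f
≈-sym p n = sym (p n)

≈-trans : ∀ {f g h} → f ≈ g → g ≈ h → f ≈ h
≈-trans p q n = trans (p n) (q n)

≡⇒≈ : ∀ {f g} → f ≡ g → f ≈ g
≡⇒≈ refl = ≈-refl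

⊕-cong : ∀ {f f′ g g′} → f ≈ f′ → g ≈ g′ → f ⊕ g ≈ f′ ⊕ g′
⊕-cong p q n = cong₂ ℤ._+_ (p n) (q n)

⊝-cong : ∀ {f f′} → f ≈ f′ → ⊝ f ≈ ⊝ f′
⊝-cong p n = cong ℤ.-_ (p n)

⊛-cong : ∀ {f f′ g g′} → f ≈ f′ → g ≈ g′ → f ⊛ g ≈ f′ ⊛ g′
⊛-cong p q zero    = cong₂ ℤ._*_ (p 0) (q 0)
⊛-cong p q (suc n) =
  cong₂ ℤ._+_ (cong₂ ℤ._*_ (p 0) (q (suc n))) (⊛-cong (λ k → p (suc k)) q n)

const-0 : ∀ n → 0ₛ n ≡ + 0
const-0 zero    = refl
const-0 (suc n) = refl

⊛-zeroˡ-pointwise : ∀ f g → (∀ n → f n ≡ + 0) → f ⊛ g ≈ 0ₛ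
⊛-zeroˡ-pointwise f g f≡0 zero rewrite f≡0 0 = refl
⊛-zeroˡ-pointwise f g f≡0 (suc n) rewrite f≡0 0 =
  trans (ℤₚ.+-identityˡ _)
    (trans (⊛-zeroˡ-pointwise (tail f) g (λ k → f≡0 (suc k)) n) (const-0 n))

⊛-identityˡ : ∀ g → 1ₛ ⊛ g ≈ g
⊛-identityˡ g zero    = ℤₚ.*-identityˡ (g 0)
⊛-identityˡ g (suc n) = begin
  + 1 ℤ.* g (suc n) ℤ.+ (tail 1ₛ ⊛ g) n
    ≡⟨ cong₂ ℤ._+_ (ℤₚ.*-identityˡ (g (suc n))) (⊛-zeroˡ-pointwise (tail 1ₛ) g (λ _ → refl) n) ⟩
  g (suc n) ℤ.+ 0ₛ n                    ≡⟨ cong (ℤ._+_ (g (suc n))) (const-0 n) ⟩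
  g (suc n) ℤ.+ + 0                     ≡⟨ ℤₚ.+-identityʳ _ ⟩
  g (suc n)                             ∎
  where open ≡-Reasoning

⊛-distribʳ-⊕ : ∀ f f′ g → (f ⊕ f′) ⊛ g ≈ f ⊛ g ⊕ f′ ⊛ g
⊛-distribʳ-⊕ f f′ g zero    = ℤₚ.*-distribʳ-+ (g 0) (f 0) (f′ 0)
⊛-distribʳ-⊕ f f′ g (suc n)
  rewrite ⊛-distribʳ-⊕ (tail f) (tail f′) g n =
  regroup (f 0) (f′ 0) (g (suc n)) ((tail f ⊛ g) n) ((tail f′ ⊛ g) n)
  where
  regroup : ∀ a b c x v → (a ℤ.+ b) ℤ.* c ℤ.+ (x ℤ.+ v) ≡ (a ℤ.* c ℤ.+ x) ℤ.+ (b ℤ.* c ℤ.+ v)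
  regroup = solve-ℤ

⊛-distribˡ-⊕ : ∀ f g g′ → f ⊛ (g ⊕ g′) ≈ f ⊛ g ⊕ f ⊛ g′
⊛-distribˡ-⊕ f g g′ zero    = ℤₚ.*-distribˡ-+ (f 0) (g 0) (g′ 0)
⊛-distribˡ-⊕ f g g′ (suc n)
  rewrite ⊛-distribˡ-⊕ (tail f) g g′ n =
  regroup (f 0) (g (suc n)) (g′ (suc n)) ((tail f ⊛ g) n) ((tail f ⊛ g′) n)
  where
  regroup : ∀ a b c x v → a ℤ.* (b ℤ.+ c) ℤ.+ (x ℤ.+ v) ≡ (a ℤ.* b ℤ.+ x) ℤ.+ (a ℤ.* c ℤ.+ v)
  regroup = solve-ℤ

·-⊛ : ∀ c f g → (c · f) ⊛ g ≈ c · (f ⊛ g)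
·-⊛ c f g zero    = ℤₚ.*-assoc c (f 0) (g 0)
·-⊛ c f g (suc n) rewrite ·-⊛ c (tail f) g n =
  regroup c (f 0) (g (suc n)) ((tail f ⊛ g) n)
  where
  regroup : ∀ c a b x → c ℤ.* a ℤ.* b ℤ.+ c ℤ.* x ≡ c ℤ.* (a ℤ.* b ℤ.+ x)
  regroup = solve-ℤ

⊛-suc-tailʳ : ∀ f g n → (f ⊛ g) (suc n) ≡ f (suc n) ℤ.* g 0 ℤ.+ (f ⊛ tail g) n
⊛-suc-tailʳ f g zero = ℤₚ.+-comm (f 0 ℤ.* g 1) (f 1 ℤ.* g 0)
⊛-suc-tailʳ f g (suc n) rewrite ⊛-suc-tailʳ (tail f) g n =
  swap (f 0 ℤ.* g (suc (suc n))) (f (suc (suc n)) ℤ.* g 0) ((tail f ⊛ tail g) n)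
  where
  swap : ∀ a b x → a ℤ.+ (b ℤ.+ x) ≡ b ℤ.+ (a ℤ.+ x)
  swap = solve-ℤ

⊛-comm : ∀ f g → f ⊛ g ≈ g ⊛ f
⊛-comm f g zero    = ℤₚ.*-comm (f 0) (g 0)
⊛-comm f g (suc n) rewrite ⊛-comm (tail f) g n | ⊛-suc-tailʳ g f n =
  cong (ℤ._+ (g ⊛ tail f) n) (ℤₚ.*-comm (f 0) (g (suc n)))

⊛-assoc : ∀ f g h → (f ⊛ g) ⊛ h ≈ f ⊛ (g ⊛ h)
⊛-assoc f g h zero    = ℤₚ.*-assoc (f 0) (g 0) (h 0)
⊛-assoc f g h (suc n) =
  trans (cong (ℤ._+_ ((f ⊛ g) 0 ℤ.* h (suc n)))
          (trans (⊛-distribʳ-⊕ (f 0 · tail g) (tail f ⊛ g) h n)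
                 (cong₂ ℤ._+_ (·-⊛ (f 0) (tail g) h n) (⊛-assoc (tail f) g h n))))
        (regroup (f 0) (g 0) (h (suc n)) ((tail g ⊛ h) n) ((tail f ⊛ (g ⊛ h)) n))
  where
  regroup : ∀ a b c x v → a ℤ.* b ℤ.* c ℤ.+ (a ℤ.* x ℤ.+ v) ≡ a ℤ.* (b ℤ.* c ℤ.+ x) ℤ.+ v
  regroup = solve-ℤ

⊛-identityʳ : ∀ f → f ⊛ 1ₛ ≈ f
⊛-identityʳ f = ≈-trans (⊛-comm f 1ₛ) (⊛-identityˡ f)

⊕-identityˡ : ∀ f → 0ₛ ⊕ f ≈ f
⊕-identityˡ f n = trans (cong (ℤ._+ f n) (const-0 n)) (ℤₚ.+-identityˡ (f n))

⊕-identityʳ : ∀ f → f ⊕ 0ₛ ≈ f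
⊕-identityʳ f n = trans (cong (ℤ._+_ (f n)) (const-0 n)) (ℤₚ.+-identityʳ (f n))

ℤ[[q]]-isCommutativeRing : IsCommutativeRing _≈_ _⊕_ _⊛_ ⊝_ 0ₛ 1ₛ
ℤ[[q]]-isCommutativeRing = record
  { isRing = record
    { +-isAbelianGroup = record
      { isGroup = record
        { isMonoid = record
          { isSemigroup = record
            { isMagma = record
              { isEquivalence = record { refl = ≈-refl ; sym = ≈-sym ; trans = ≈-trans }
              ; ∙-cong = ⊕-cong }
            ; assoc = λ f g h n → ℤₚ.+-assoc (f n) (g n) (h n) }
          ; identity = ⊕-identityˡ , ⊕-identityʳ }
        ; inverse = (λ f n → trans (ℤₚ.+-inverseˡ (f n)) (sym (const-0 n)))
                  , (λ f n → trans (ℤₚ.+-inverseʳ (f n)) (sym (const-0 n)))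
        ; ⁻¹-cong = ⊝-cong }
      ; comm = λ f g n → ℤₚ.+-comm (f n) (g n) }
    ; *-cong = ⊛-cong
    ; *-assoc = ⊛-assoc
    ; *-identity = ⊛-identityˡ , ⊛-identityʳ
    ; distrib = ⊛-distribˡ-⊕ , (λ g f f′ → ⊛-distribʳ-⊕ f f′ g) }
  ; *-comm = ⊛-comm }

ℤ[[q]]-commutativeRing : CommutativeRing _ _
ℤ[[q]]-commutativeRing = record { isCommutativeRing = ℤ[[q]]-isCommutativeRing }

const-⊛ : ∀ c f n → (const c ⊛ f) n ≡ c ℤ.* f n
const-⊛ c f zero    = refl
const-⊛ c f (suc n) = begin
  c ℤ.* f (suc n) ℤ.+ (tail (const c) ⊛ f) n
    ≡⟨ cong (ℤ._+_ (c ℤ.* f (suc n))) (⊛-zeroˡ-pointwise (tail (const c)) f (λ _ → refl) n) ⟩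
  c ℤ.* f (suc n) ℤ.+ 0ₛ n                   ≡⟨ cong (ℤ._+_ (c ℤ.* f (suc n))) (const-0 n) ⟩
  c ℤ.* f (suc n) ℤ.+ + 0                    ≡⟨ ℤₚ.+-identityʳ _ ⟩
  c ℤ.* f (suc n)                            ∎
  where open ≡-Reasoning

const-* : ∀ a b → const (a ℤ.* b) ≈ const a ⊛ const b
const-* a b zero    = refl
const-* a b (suc n) = sym (trans (const-⊛ a (const b) (suc n)) (ℤₚ.*-zeroʳ a))

const-morphism : ℤ.+-*-rawRing -Raw-AlmostCommutative⟶ fromCommutativeRing ℤ[[q]]-commutativeRing
const-morphism = record
  { ⟦_⟧    = const
  ; +-homo = λ { a b zero → refl ; a b (suc n) → refl }
  ; *-homo = const-*
  ; -‿homo = λ { a zero → refl ; a (suc n) → refl }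
  ; 0-homo = λ { zero → refl ; (suc n) → refl }
  ; 1-homo = ≈-refl }

const-≟ : ∀ a b → Maybe (const a ≈ const b)
const-≟ a b with a ℤ.≟ b
... | yes refl = just ≈-refl
... | no _     = nothing

open Algebra.Solver.Ring ℤ.+-*-rawRing (fromCommutativeRing ℤ[[q]]-commutativeRing) const-morphism const-≟
  using (solve; _:=_; _:+_; _:*_; :-_; con)

module ≈-Reasoning = SetoidReasoning (CommutativeRing.setoid ℤ[[q]]-commutativeRing)

open import Algebra.Properties.CommutativeSemiring.Exp
  (CommutativeRing.commutativeSemiring ℤ[[q]]-commutativeRing)
  using (^-congˡ; ^-homo-*; ^-assocʳ; ^-distrib-*) renaming (_^_ to _⊛^_)

shift : ℕ → ℤ[[q]] → ℤ[[q]]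
shift zero    f n       = f n
shift (suc m) f zero    = + 0
shift (suc m) f (suc n) = shift m f n

q^_ : ℕ → ℤ[[q]]
q^ m = shift m 1ₛ

shift-at : ∀ m f n → shift m f (m + n) ≡ f n
shift-at zero    f n = refl
shift-at (suc m) f n = shift-at m f n

shift-below : ∀ m f {n} → n < m → shift m f n ≡ + 0
shift-below (suc m) f {zero}  _         = refl
shift-below (suc m) f {suc n} (s≤s n<m) = shift-below m f n<m

shift-cong : ∀ m {f g} → f ≈ g → shift m f ≈ shift m g
shift-cong zero    f≈g n       = f≈g n
shift-cong (suc m) f≈g zero    = refl
shift-cong (suc m) f≈g (suc n) = shift-cong m f≈g n

shift-⊛ : ∀ m f g → shift m f ⊛ g ≈ shift m (f ⊛ g)
shift-⊛ zero    f g n       = refl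
shift-⊛ (suc m) f g zero    = refl
shift-⊛ (suc m) f g (suc n) = trans (ℤₚ.+-identityˡ _) (shift-⊛ m f g n)

shift≈q^⊛ : ∀ m f → shift m f ≈ q^ m ⊛ f
shift≈q^⊛ m f = ≈-sym (≈-trans (shift-⊛ m 1ₛ f) (shift-cong m (⊛-identityˡ f)))

q^-+ : ∀ m n → q^ (m + n) ≈ q^ m ⊛ q^ n
q^-+ m n = ≈-trans (shift-+ m) (shift≈q^⊛ m (q^ n))
  where
  shift-+ : ∀ m → shift (m + n) 1ₛ ≈ shift m (shift n 1ₛ)
  shift-+ zero    = ≈-refl
  shift-+ (suc m) zero    = refl
  shift-+ (suc m) (suc k) = shift-+ m k

q^-cong : ∀ {m n} → m ≡ n → q^ m ≈ q^ n
q^-cong refl = ≈-refl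

2*k≡k+k : ∀ k → 2 * k ≡ k + k
2*k≡k+k k = cong (_+_ k) (ℕₚ.+-identityʳ k)

infix 4 _≈[_]_
_≈[_]_ : ℤ[[q]] → ℕ → ℤ[[q]] → Set
f ≈[ M ] g = ∀ n → n < M → f n ≡ g n

≈⇒≈[] : ∀ {f g} M → f ≈ g → f ≈[ M ] g
≈⇒≈[] M f≈g n _ = f≈g n

≈[]-refl : ∀ {f M} → f ≈[ M ] f
≈[]-refl _ _ = refl

≈[]-sym : ∀ {f g M} → f ≈[ M ] g → g ≈[ M ] f
≈[]-sym p n n<M = sym (p n n<M)

≈[]-trans : ∀ {f g h M} → f ≈[ M ] g → g ≈[ M ] h → f ≈[ M ] h
≈[]-trans p q n n<M = trans (p n n<M) (q n n<M)

≈[]-mono : ∀ {f g M M′} → M′ ≤ M → f ≈[ M ] g → f ≈[ M′ ] g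
≈[]-mono M′≤M p n n<M′ = p n (ℕₚ.≤-trans n<M′ M′≤M)

≈[]-setoid : ℕ → Setoid _ _
≈[]-setoid M = record
  { Carrier       = ℤ[[q]]
  ; _≈_           = _≈[ M ]_
  ; isEquivalence = record { refl = ≈[]-refl ; sym = ≈[]-sym ; trans = ≈[]-trans }
  }

module ≈[]-Reasoning (M : ℕ) = SetoidReasoning (≈[]-setoid M)

≈[]-respects-≈ : ∀ {f f′ g g′ M} → f ≈ f′ → g ≈ g′ → f ≈[ M ] g → f′ ≈[ M ] g′
≈[]-respects-≈ f≈f′ g≈g′ p n n<M = trans (sym (f≈f′ n)) (trans (p n n<M) (g≈g′ n))

⊕-cong[] : ∀ {f f′ g g′ M} → f ≈[ M ] f′ → g ≈[ M ] g′ → f ⊕ g ≈[ M ] f′ ⊕ g′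
⊕-cong[] p q n n<M = cong₂ ℤ._+_ (p n n<M) (q n n<M)

⊛-cong[] : ∀ {f f′ g g′ M} → f ≈[ M ] f′ → g ≈[ M ] g′ → f ⊛ g ≈[ M ] f′ ⊛ g′
⊛-cong[] {M = suc M} p q zero    n<M       = cong₂ ℤ._*_ (p 0 n<M) (q 0 n<M)
⊛-cong[] {M = suc M} p q (suc n) (s≤s n<M) =
  cong₂ ℤ._+_ (cong₂ ℤ._*_ (p 0 (s≤s z≤n)) (q (suc n) (s≤s n<M)))
              (⊛-cong[] {M = M} (λ k k<M → p (suc k) (s≤s k<M)) (λ k k<M → q k (ℕₚ.m<n⇒m<1+n k<M)) n n<M)

⊛^-cong[] : ∀ {f g M} k → f ≈[ M ] g → f ⊛^ k ≈[ M ] g ⊛^ k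
⊛^-cong[] zero    p = ≈[]-refl
⊛^-cong[] (suc k) p = ⊛-cong[] p (⊛^-cong[] k p)

shift-cong[] : ∀ m {f g M} → f ≈[ M ] g → shift m f ≈[ m + M ] shift m g
shift-cong[] zero    p = p
shift-cong[] (suc m) p zero    _         = refl
shift-cong[] (suc m) p (suc n) (s≤s n<M) = shift-cong[] m p n n<M

q^⊛-cong[] : ∀ m {f g M} → f ≈[ M ] g → q^ m ⊛ f ≈[ m + M ] q^ m ⊛ g
q^⊛-cong[] m {f} {g} p =
  ≈[]-respects-≈ (shift≈q^⊛ m f) (shift≈q^⊛ m g) (shift-cong[] m p)

q^⊛≈[]0 : ∀ m f → q^ m ⊛ f ≈[ m ] 0ₛ
q^⊛≈[]0 m f n n<m = trans (sym (shift≈q^⊛ m f n)) (trans (shift-below m f n<m) (sym (const-0 n)))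

1⊕q^⊛≈[]1 : ∀ m f → 1ₛ ⊕ q^ m ⊛ f ≈[ m ] 1ₛ
1⊕q^⊛≈[]1 m f = ≈[]-trans (⊕-cong[] (≈[]-refl {1ₛ}) (q^⊛≈[]0 m f)) (≈⇒≈[] m (⊕-identityʳ 1ₛ))

≈[]1⇒⊛≈[] : ∀ {f g M} → f ≈[ M ] 1ₛ → f ⊛ g ≈[ M ] g
≈[]1⇒⊛≈[] {g = g} p = ≈[]-trans (⊛-cong[] p (≈[]-refl {g})) (≈⇒≈[] _ (⊛-identityˡ g))

∏ : (ℕ → ℤ[[q]]) → ℕ → ℤ[[q]]
∏ F zero    = 1ₛ
∏ F (suc N) = F (suc N) ⊛ ∏ F N

∏-cong : ∀ {F G} N → (∀ m → F (suc m) ≈ G (suc m)) → ∏ F N ≈ ∏ G N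
∏-cong zero    F≈G = ≈-refl
∏-cong (suc N) F≈G = ⊛-cong (F≈G N) (∏-cong N F≈G)

∏-1 : ∀ {F} N → (∀ m → F (suc m) ≈ 1ₛ) → ∏ F N ≈ 1ₛ
∏-1 zero    F≈1 = ≈-refl
∏-1 (suc N) F≈1 = ≈-trans (⊛-cong (F≈1 N) (∏-1 N F≈1)) (⊛-identityˡ 1ₛ)

∏-⊛ : ∀ F G N → ∏ (λ m → F m ⊛ G m) N ≈ ∏ F N ⊛ ∏ G N
∏-⊛ F G zero    = ≈-sym (⊛-identityˡ 1ₛ)
∏-⊛ F G (suc N) = ≈-trans (⊛-cong ≈-refl (∏-⊛ F G N)) (interchange _ _ _ _)
  where
  interchange : ∀ a b c d → (a ⊛ b) ⊛ (c ⊛ d) ≈ (a ⊛ c) ⊛ (b ⊛ d)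
  interchange = solve 4 (λ a b c d → (a :* b) :* (c :* d) := (a :* c) :* (b :* d)) ≈-refl

1ₛ⊛^ : ∀ k → 1ₛ ⊛^ k ≈ 1ₛ
1ₛ⊛^ zero    = ≈-refl
1ₛ⊛^ (suc k) = ≈-trans (⊛-identityˡ _) (1ₛ⊛^ k)

∏-⊛^ : ∀ F k N → ∏ (λ m → F m ⊛^ k) N ≈ ∏ F N ⊛^ k
∏-⊛^ F k zero    = ≈-sym (1ₛ⊛^ k)
∏-⊛^ F k (suc N) =
  ≈-trans (⊛-cong ≈-refl (∏-⊛^ F k N)) (≈-sym (^-distrib-* (F (suc N)) (∏ F N) k))

∏-extend : ∀ F M N → (∀ m → N < m → F m ≈[ M ] 1ₛ) → ∀ k → ∏ F (k + N) ≈[ M ] ∏ F N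
∏-extend F M N F≈1 zero    = ≈[]-refl
∏-extend F M N F≈1 (suc k) =
  ≈[]-trans (≈[]1⇒⊛≈[] (F≈1 (suc (k + N)) (s≤s (ℕₚ.m≤n+m N k)))) (∏-extend F M N F≈1 k)

q^-off : ∀ a n → a ≢ n → (q^ a) n ≡ + 0
q^-off a n a≢n with ℕₚ.<-cmp n a
... | tri< n<a _ _ = shift-below a 1ₛ n<a
... | tri≈ _ n≡a _ = ⊥-elim (a≢n (sym n≡a))
... | tri> _ _ a<n with ℕₚ.m≤n⇒∃[o]m+o≡n (ℕₚ.<⇒≤ a<n)
...   | zero  , a+0≡n  = ⊥-elim (a≢n (trans (sym (ℕₚ.+-identityʳ a)) a+0≡n))
...   | suc o , refl   = shift-at a 1ₛ (suc o)

-- The generating function of ā_{r,s}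
embed : Series → ℤ[[q]]
embed f n = + f n

-- geometric m = 1/(1 - q^m) and overpartFactor m = (1 + q^m)/(1 - q^m).
onePlus oneMinus geometric overpartFactor : ℕ → ℤ[[q]]
onePlus m        = 1ₛ ⊕ q^ m
oneMinus m       = 1ₛ ⊕ ⊝ q^ m
geometric m      = embed (divMinus m one)
overpartFactor m = onePlus m ⊛ geometric m

embed-one : embed one ≈ 1ₛ
embed-one zero    = refl
embed-one (suc n) = refl

≤ᵇ-suc : ∀ m n → (suc m ≤ᵇ suc n) ≡ (m ≤ᵇ n)
≤ᵇ-suc zero    n = refl
≤ᵇ-suc (suc m) n = refl

≤ᵇ-+ : ∀ m n o → (m + n ≤ᵇ m + o) ≡ (n ≤ᵇ o)
≤ᵇ-+ zero    n o = refl
≤ᵇ-+ (suc m) n o = trans (≤ᵇ-suc (m + n) (m + o)) (≤ᵇ-+ m n o)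

≤⇒≤ᵇ≡true : ∀ {m n} → m ≤ n → (m ≤ᵇ n) ≡ true
≤⇒≤ᵇ≡true m≤n = Equivalence.to T-≡ (ℕₚ.≤⇒≤ᵇ m≤n)

<⇒≤ᵇ≡false : ∀ {m n} → n < m → (m ≤ᵇ n) ≡ false
<⇒≤ᵇ≡false {m} {n} n<m = ¬-not (λ m≤ᵇn → ℕₚ.<⇒≱ n<m (ℕₚ.≤ᵇ⇒≤ m n (Equivalence.from T-≡ m≤ᵇn)))

shift-if : ∀ m g n → shift m g n ≡ (if m ≤ᵇ n then g (n ∸ m) else + 0)
shift-if zero    g n       = refl
shift-if (suc m) g zero    = refl
shift-if (suc m) g (suc n) =
  trans (shift-if m g n) (cong (λ b → if b then g (n ∸ m) else + 0) (sym (≤ᵇ-suc m n)))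

onePlus-⊛ : ∀ m g → onePlus m ⊛ g ≈ g ⊕ shift m g
onePlus-⊛ m g =
  ≈-trans (⊛-distribʳ-⊕ 1ₛ (q^ m) g) (⊕-cong (⊛-identityˡ g) (≈-sym (shift≈q^⊛ m g)))

oneMinus-⊛ : ∀ m g → oneMinus m ⊛ g ≈ g ⊕ ⊝ shift m g
oneMinus-⊛ m g = begin
  (1ₛ ⊕ ⊝ q^ m) ⊛ g    ≈⟨ solve 2 (λ x g → (con (+ 1) :+ :- x) :* g := g :+ :- (x :* g)) ≈-refl (q^ m) g ⟩
  g ⊕ ⊝ (q^ m ⊛ g)     ≈⟨ ⊕-cong (≈-refl {g}) (⊝-cong (≈-sym (shift≈q^⊛ m g))) ⟩
  g ⊕ ⊝ shift m g      ∎
  where open ≈-Reasoning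

embed-mulPlus : ∀ m f → embed (mulPlus m f) ≈ onePlus m ⊛ embed f
embed-mulPlus m f = ≈-trans coefficientwise (≈-sym (onePlus-⊛ m (embed f)))
  where
  coefficientwise : embed (mulPlus m f) ≈ embed f ⊕ shift m (embed f)
  coefficientwise n rewrite shift-if m (embed f) n with m ≤ᵇ n
  ... | true  = refl
  ... | false = refl

Σ< : ℕ → (ℕ → ℕ) → ℕ
Σ< L h = sum (applyUpTo h L)

Σ<-suc : ∀ L h → Σ< (suc L) h ≡ Σ< L h + h L
Σ<-suc L h = begin
  sum (applyUpTo h (suc L))                ≡⟨ cong sum (sym (applyUpTo-∷ʳ h L)) ⟩
  sum (applyUpTo h L Data.List.∷ʳ h L)     ≡⟨ sum-++ (applyUpTo h L) _ ⟩
  Σ< L h + (h L + 0)                       ≡⟨ cong (_+_ (Σ< L h)) (ℕₚ.+-identityʳ (h L)) ⟩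
  Σ< L h + h L                             ∎
  where open ≡-Reasoning

Σ<-cong : ∀ L {h h′} → (∀ t → t < L → h t ≡ h′ t) → Σ< L h ≡ Σ< L h′
Σ<-cong zero    h≡h′ = refl
Σ<-cong (suc L) h≡h′ =
  cong₂ _+_ (h≡h′ 0 (s≤s z≤n)) (Σ<-cong L (λ t t<L → h≡h′ (suc t) (s≤s t<L)))

Σ<-stable : ∀ L h → (∀ t → L ≤ t → h t ≡ 0) → ∀ k → Σ< (k + L) h ≡ Σ< L h
Σ<-stable L h h≡0 zero    = refl
Σ<-stable L h h≡0 (suc k) = begin
  Σ< (suc (k + L)) h          ≡⟨ Σ<-suc (k + L) h ⟩
  Σ< (k + L) h + h (k + L)    ≡⟨ cong₂ _+_ (Σ<-stable L h h≡0 k) (h≡0 (k + L) (ℕₚ.m≤n+m L k)) ⟩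
  Σ< L h + 0                  ≡⟨ ℕₚ.+-identityʳ _ ⟩
  Σ< L h                      ∎
  where open ≡-Reasoning

divMinusTerm : ℕ → Series → ℕ → ℕ → ℕ
divMinusTerm m f n t = if m * t ≤ᵇ n then f (n ∸ m * t) else 0

divMinus≡Σ< : ∀ m f n → divMinus m f n ≡ Σ< (suc n) (divMinusTerm m f n)
divMinus≡Σ< m f n = cong sum (map-upTo (divMinusTerm m f n) (suc n))

divMinusTerm-zero : ∀ m f n → divMinusTerm m f n 0 ≡ f n
divMinusTerm-zero m f n rewrite ℕₚ.*-zeroʳ m = refl

divMinusTerm-suc : ∀ m f o t → divMinusTerm m f (m + o) (suc t) ≡ divMinusTerm m f o t
divMinusTerm-suc m f o t
  rewrite ℕₚ.*-suc m t | ≤ᵇ-+ m (m * t) o | ℕₚ.[m+n]∸[m+o]≡n∸o m o (m * t) = refl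

divMinusTerm-vanishes : ∀ m f n t → n < m * t → divMinusTerm m f n t ≡ 0
divMinusTerm-vanishes m f n t n<mt rewrite <⇒≤ᵇ≡false n<mt = refl

divMinus-below : ∀ m f n → n < m → divMinus m f n ≡ f n
divMinus-below m f n n<m = begin
  divMinus m f n                     ≡⟨ divMinus≡Σ< m f n ⟩
  Σ< (suc n) (divMinusTerm m f n)    ≡⟨ cong (λ L → Σ< L (divMinusTerm m f n)) (ℕₚ.+-comm 1 n) ⟩
  Σ< (n + 1) (divMinusTerm m f n)    ≡⟨ Σ<-stable 1 _ higher-terms-vanish n ⟩
  divMinusTerm m f n 0 + 0           ≡⟨ ℕₚ.+-identityʳ _ ⟩
  divMinusTerm m f n 0               ≡⟨ divMinusTerm-zero m f n ⟩
  f n                                ∎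
  where
  open ≡-Reasoning
  higher-terms-vanish : ∀ t → 1 ≤ t → divMinusTerm m f n t ≡ 0
  higher-terms-vanish t@(suc _) _ =
    divMinusTerm-vanishes m f n t (ℕₚ.<-≤-trans n<m (ℕₚ.m≤m*n m t))

divMinus-+ : ∀ m f o → 1 ≤ m → divMinus m f (m + o) ≡ f (m + o) + divMinus m f o
divMinus-+ m@(suc m′) f o _ = begin
  divMinus m f (m + o)                                          ≡⟨ divMinus≡Σ< m f (m + o) ⟩
  divMinusTerm m f (m + o) 0 + Σ< (m + o) (divMinusTerm m f (m + o) ∘ suc)
    ≡⟨ cong₂ _+_ (divMinusTerm-zero m f (m + o)) (Σ<-cong (m + o) (λ t _ → divMinusTerm-suc m f o t)) ⟩
  f (m + o) + Σ< (m + o) (divMinusTerm m f o)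
    ≡⟨ cong (λ L → f (m + o) + Σ< L (divMinusTerm m f o)) (sym (ℕₚ.+-suc m′ o)) ⟩
  f (m + o) + Σ< (m′ + suc o) (divMinusTerm m f o)
    ≡⟨ cong (_+_ (f (m + o))) (Σ<-stable (suc o) _ beyond-o-vanish m′) ⟩
  f (m + o) + Σ< (suc o) (divMinusTerm m f o)                   ≡⟨ cong (_+_ (f (m + o))) (sym (divMinus≡Σ< m f o)) ⟩
  f (m + o) + divMinus m f o                                    ∎
  where
  open ≡-Reasoning
  beyond-o-vanish : ∀ t → suc o ≤ t → divMinusTerm m f o t ≡ 0
  beyond-o-vanish t o<t = divMinusTerm-vanishes m f o t (ℕₚ.<-≤-trans o<t (ℕₚ.m≤n*m t m))

embed-divMinus-rec : ∀ m f → 1 ≤ m → embed (divMinus m f) ≈ embed f ⊕ shift m (embed (divMinus m f))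
embed-divMinus-rec m f 1≤m n rewrite shift-if m (embed (divMinus m f)) n with ℕₚ.≤-<-connex m n
... | inj₁ m≤n with ℕₚ.m≤n⇒∃[o]m+o≡n m≤n
...   | o , refl rewrite ≤⇒≤ᵇ≡true m≤n | ℕₚ.m+n∸m≡n m o = cong +_ (divMinus-+ m f o 1≤m)
embed-divMinus-rec m f 1≤m n | inj₂ n<m
  rewrite <⇒≤ᵇ≡false n<m = cong +_ (trans (divMinus-below m f n n<m) (sym (ℕₚ.+-identityʳ (f n))))

oneMinus-⊛-solution : ∀ m F G → G ≈ F ⊕ shift m G → oneMinus m ⊛ G ≈ F
oneMinus-⊛-solution m F G G≈F+qᵐG = begin
  oneMinus m ⊛ G              ≈⟨ oneMinus-⊛ m G ⟩
  G ⊕ ⊝ shift m G             ≈⟨ ⊕-cong G≈F+qᵐG (≈-refl {⊝ shift m G}) ⟩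
  F ⊕ shift m G ⊕ ⊝ shift m G ≈⟨ solve 2 (λ f g → f :+ g :+ :- g := f) ≈-refl F (shift m G) ⟩
  F                           ∎
  where open ≈-Reasoning

geometric-rec : ∀ m → 1 ≤ m → geometric m ≈ 1ₛ ⊕ q^ m ⊛ geometric m
geometric-rec m 1≤m =
  ≈-trans (embed-divMinus-rec m one 1≤m) (⊕-cong embed-one (shift≈q^⊛ m (geometric m)))

oneMinus⊛geometric : ∀ m → 1 ≤ m → oneMinus m ⊛ geometric m ≈ 1ₛ
oneMinus⊛geometric m 1≤m = oneMinus-⊛-solution m 1ₛ (geometric m)
  (≈-trans (embed-divMinus-rec m one 1≤m) (⊕-cong embed-one ≈-refl))

⊛-inverse-solve : ∀ {u v F G} → u ⊛ v ≈ 1ₛ → u ⊛ G ≈ F → G ≈ v ⊛ F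
⊛-inverse-solve {u} {v} {F} {G} uv≈1 uG≈F = begin
  G             ≈⟨ ⊛-identityˡ G ⟨
  1ₛ ⊛ G        ≈⟨ ⊛-cong (≈-trans (⊛-comm v u) uv≈1) (≈-refl {G}) ⟨
  (v ⊛ u) ⊛ G   ≈⟨ ⊛-assoc v u G ⟩
  v ⊛ (u ⊛ G)   ≈⟨ ⊛-cong (≈-refl {v}) uG≈F ⟩
  v ⊛ F         ∎
  where open ≈-Reasoning

embed-divMinus : ∀ m f → 1 ≤ m → embed (divMinus m f) ≈ geometric m ⊛ embed f
embed-divMinus m f 1≤m = ⊛-inverse-solve (oneMinus⊛geometric m 1≤m)
  (oneMinus-⊛-solution m (embed f) (embed (divMinus m f)) (embed-divMinus-rec m f 1≤m))

embed-overpartStep : ∀ m g → 1 ≤ m → embed (divMinus m (mulPlus m g)) ≈ overpartFactor m ⊛ embed g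
embed-overpartStep m g 1≤m = begin
  embed (divMinus m (mulPlus m g))    ≈⟨ embed-divMinus m (mulPlus m g) 1≤m ⟩
  geometric m ⊛ embed (mulPlus m g)   ≈⟨ ⊛-cong (≈-refl {geometric m}) (embed-mulPlus m g) ⟩
  geometric m ⊛ (onePlus m ⊛ embed g) ≈⟨ ⊛-assoc (geometric m) (onePlus m) (embed g) ⟨
  (geometric m ⊛ onePlus m) ⊛ embed g ≈⟨ ⊛-cong (⊛-comm (geometric m) (onePlus m)) (≈-refl {embed g}) ⟩
  overpartFactor m ⊛ embed g          ∎
  where open ≈-Reasoning

embed-iter : ∀ m c g → 1 ≤ m →
  embed (iter c (λ h → divMinus m (mulPlus m h)) g) ≈ overpartFactor m ⊛^ c ⊛ embed g
embed-iter m zero    g 1≤m = ≈-sym (⊛-identityˡ (embed g))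
embed-iter m (suc c) g 1≤m = ≈-trans (embed-overpartStep m _ 1≤m)
  (≈-trans (⊛-cong ≈-refl (embed-iter m c g 1≤m)) (≈-sym (⊛-assoc (overpartFactor m) _ (embed g))))

coloured : ℕ → ℕ → ℕ → ℤ[[q]]
coloured r s m = overpartFactor m ⊛^ colours r s m

embed-prodUpTo : ∀ r s N → embed (prodUpTo r s N) ≈ ∏ (coloured r s) N
embed-prodUpTo r s zero    = embed-one
embed-prodUpTo r s (suc N) =
  ≈-trans (embed-iter (suc N) (colours r s (suc N)) (prodUpTo r s N) (s≤s z≤n))
          (⊛-cong ≈-refl (embed-prodUpTo r s N))

abar≡coefficient : ∀ r s n → + abar r s n ≡ ∏ (coloured r s) n n
abar≡coefficient r s n = embed-prodUpTo r s n n

-- Gaussian polynomials and the finite Jacobi triple product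
q² : ℤ[[q]]
q² = q^ 2

-- The Gaussian binomial coefficient [a + b choose a] in the variable q².
gaussian : ℕ → ℕ → ℤ[[q]]
gaussian a       zero    = 1ₛ
gaussian zero    (suc b) = 1ₛ
gaussian (suc a) (suc b) = gaussian (suc a) b ⊕ q² ⊛^ suc b ⊛ gaussian a (suc b)

gaussian-pascal′ : ∀ a b →
  gaussian (suc a) (suc b) ≈ gaussian a (suc b) ⊕ q² ⊛^ suc a ⊛ gaussian (suc a) b
gaussian-pascal′ zero    zero    = ≈-refl
gaussian-pascal′ zero    (suc b) =
  ≈-trans (⊕-cong (gaussian-pascal′ zero b) ≈-refl) (regroup q² (q² ⊛^ suc b) (gaussian 1 b))
  where
  regroup : ∀ x v g → (1ₛ ⊕ (x ⊛ 1ₛ) ⊛ g) ⊕ (x ⊛ v) ⊛ 1ₛ ≈ 1ₛ ⊕ (x ⊛ 1ₛ) ⊛ (g ⊕ v ⊛ 1ₛ)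
  regroup = solve 3 (λ x v g → (con (+ 1) :+ (x :* con (+ 1)) :* g) :+ (x :* v) :* con (+ 1)
                            := con (+ 1) :+ (x :* con (+ 1)) :* (g :+ v :* con (+ 1))) ≈-refl
gaussian-pascal′ (suc a) zero    =
  ≈-trans (⊕-cong (≈-refl {1ₛ}) (⊛-cong (≈-refl {q² ⊛^ 1}) (gaussian-pascal′ a zero)))
          (regroup q² (q² ⊛^ suc a) (gaussian a 1))
  where
  regroup : ∀ x v g → 1ₛ ⊕ (x ⊛ 1ₛ) ⊛ (g ⊕ v ⊛ 1ₛ) ≈ (1ₛ ⊕ (x ⊛ 1ₛ) ⊛ g) ⊕ (x ⊛ v) ⊛ 1ₛ
  regroup = solve 3 (λ x v g → con (+ 1) :+ (x :* con (+ 1)) :* (g :+ v :* con (+ 1))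
                            := (con (+ 1) :+ (x :* con (+ 1)) :* g) :+ (x :* v) :* con (+ 1)) ≈-refl
gaussian-pascal′ (suc a) (suc b) =
  ≈-trans (⊕-cong (gaussian-pascal′ (suc a) b) (⊛-cong ≈-refl (gaussian-pascal′ a (suc b))))
          (regroup q² (q² ⊛^ suc a) (q² ⊛^ suc b) (gaussian (suc a) (suc b)) (gaussian (suc (suc a)) b) (gaussian a (suc (suc b))))
  where
  regroup : ∀ x A B g h k → (g ⊕ (x ⊛ A) ⊛ h) ⊕ (x ⊛ B) ⊛ (k ⊕ A ⊛ g)
                          ≈ (g ⊕ (x ⊛ B) ⊛ k) ⊕ (x ⊛ A) ⊛ (h ⊕ B ⊛ g)
  regroup = solve 6 (λ x A B g h k → (g :+ (x :* A) :* h) :+ (x :* B) :* (k :+ A :* g)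
                                  := (g :+ (x :* B) :* k) :+ (x :* A) :* (h :+ B :* g)) ≈-refl

gaussian-sym : ∀ a b → gaussian a b ≈ gaussian b a
gaussian-sym zero    zero    = ≈-refl
gaussian-sym zero    (suc b) = ≈-refl
gaussian-sym (suc a) zero    = ≈-refl
gaussian-sym (suc a) (suc b) =
  ≈-trans (⊕-cong (gaussian-sym (suc a) b) (⊛-cong ≈-refl (gaussian-sym a (suc b))))
          (≈-sym (gaussian-pascal′ b a))

gaussian-step : ∀ a b → gaussian (suc (suc a)) (suc (suc b)) ≈
  (1ₛ ⊕ q² ⊛^ suc (suc b) ⊛ q² ⊛^ suc a) ⊛ gaussian (suc a) (suc b)
  ⊕ q² ⊛^ suc (suc b) ⊛ gaussian a (suc (suc b)) ⊕ q² ⊛^ suc (suc a) ⊛ gaussian (suc (suc a)) b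
gaussian-step a b =
  ≈-trans (⊕-cong (gaussian-pascal′ (suc a) b) (⊛-cong ≈-refl (gaussian-pascal′ a (suc b))))
          (regroup (q² ⊛^ suc (suc a)) (q² ⊛^ suc (suc b)) (q² ⊛^ suc a)
                   (gaussian (suc a) (suc b)) (gaussian (suc (suc a)) b) (gaussian a (suc (suc b))))
  where
  regroup : ∀ A₂ B₂ A₁ g h k →
    (g ⊕ A₂ ⊛ h) ⊕ B₂ ⊛ (k ⊕ A₁ ⊛ g) ≈ (1ₛ ⊕ B₂ ⊛ A₁) ⊛ g ⊕ B₂ ⊛ k ⊕ A₂ ⊛ h
  regroup = solve 6 (λ A₂ B₂ A₁ g h k → (g :+ A₂ :* h) :+ B₂ :* (k :+ A₁ :* g)
                                     := (con (+ 1) :+ B₂ :* A₁) :* g :+ B₂ :* k :+ A₂ :* h) ≈-refl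

gaussian-step₁ : ∀ a → gaussian (suc (suc a)) 1 ≈ (1ₛ ⊕ q² ⊛^ suc (suc a)) ⊕ q² ⊛^ 1 ⊛ gaussian a 1
gaussian-step₁ a =
  ≈-trans (⊕-cong (≈-refl {1ₛ}) (⊛-cong (≈-refl {q² ⊛^ 1}) (gaussian-pascal′ a zero)))
          (regroup q² (q² ⊛^ suc a) (gaussian a 1))
  where
  regroup : ∀ x v g → 1ₛ ⊕ (x ⊛ 1ₛ) ⊛ (g ⊕ v ⊛ 1ₛ) ≈ (1ₛ ⊕ x ⊛ v) ⊕ (x ⊛ 1ₛ) ⊛ g
  regroup = solve 3 (λ x v g → con (+ 1) :+ (x :* con (+ 1)) :* (g :+ v :* con (+ 1))
                            := (con (+ 1) :+ x :* v) :+ (x :* con (+ 1)) :* g) ≈-refl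

q²^≈q^ : ∀ k → q² ⊛^ k ≈ q^ (2 * k)
q²^≈q^ zero    = ≈-refl
q²^≈q^ (suc k) = ≈-trans (⊛-cong ≈-refl (q²^≈q^ k))
  (≈-trans (≈-sym (q^-+ 2 (2 * k))) (q^-cong (sym (ℕₚ.*-suc 2 k))))

gaussian-cong : ∀ {a a′} b → a ≡ a′ → gaussian a b ≈ gaussian a′ b
gaussian-cong b refl = ≈-refl

q^⊛q^-cong : ∀ a b c d → a + b ≡ c + d → q^ a ⊛ q^ b ≈ q^ c ⊛ q^ d
q^⊛q^-cong a b c d a+b≡c+d = ≈-trans (≈-sym (q^-+ a b)) (≈-trans (q^-cong a+b≡c+d) (q^-+ c d))

q^⊛q²^-cong : ∀ a b c d → a + 2 * b ≡ c + d → q^ a ⊛ q² ⊛^ b ≈ q^ c ⊛ q^ d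
q^⊛q²^-cong a b c d eq = ≈-trans (⊛-cong (≈-refl {q^ a}) (q²^≈q^ b)) (q^⊛q^-cong a (2 * b) c d eq)

q²^⊛q²^-cong : ∀ a b c → 2 * a + 2 * b ≡ c + c → q² ⊛^ a ⊛ q² ⊛^ b ≈ q^ c ⊛ q^ c
q²^⊛q²^-cong a b c eq = ≈-trans (⊛-cong (q²^≈q^ a) (q²^≈q^ b)) (q^⊛q^-cong (2 * a) (2 * b) c c eq)

q^odd : ℕ → ℤ[[q]]
q^odd n = q^ (suc (n + n))

gaussian-step-shifted : ∀ a b A B C Y →
  q² ⊛^ (2 + b) ⊛ q² ⊛^ suc a ≈ Y ⊛ Y → q^ A ⊛ q² ⊛^ (2 + b) ≈ Y ⊛ q^ B → q^ A ⊛ q² ⊛^ (2 + a) ≈ Y ⊛ q^ C →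
  q^ A ⊛ gaussian (2 + a) (2 + b) ≈
    (1ₛ ⊕ Y ⊛ Y) ⊛ (q^ A ⊛ gaussian (suc a) (suc b)) ⊕ Y ⊛ (q^ B ⊛ gaussian a (2 + b) ⊕ q^ C ⊛ gaussian (2 + a) b)
gaussian-step-shifted a b A B C Y y² yq^B yq^C = begin
  q^ A ⊛ gaussian (2 + a) (2 + b)
    ≈⟨ ⊛-cong (≈-refl {q^ A}) (gaussian-step a b) ⟩
  q^ A ⊛ ((1ₛ ⊕ q² ⊛^ (2 + b) ⊛ q² ⊛^ suc a) ⊛ g₁ ⊕ q² ⊛^ (2 + b) ⊛ g₂ ⊕ q² ⊛^ (2 + a) ⊛ g₃)
    ≈⟨ distribute (q^ A) (q² ⊛^ (2 + b) ⊛ q² ⊛^ suc a) (q² ⊛^ (2 + b)) (q² ⊛^ (2 + a)) g₁ g₂ g₃ ⟩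
  (1ₛ ⊕ q² ⊛^ (2 + b) ⊛ q² ⊛^ suc a) ⊛ (q^ A ⊛ g₁)
    ⊕ (q^ A ⊛ q² ⊛^ (2 + b)) ⊛ g₂ ⊕ (q^ A ⊛ q² ⊛^ (2 + a)) ⊛ g₃
    ≈⟨ ⊕-cong (⊕-cong (⊛-cong (⊕-cong (≈-refl {1ₛ}) y²) (≈-refl {q^ A ⊛ g₁})) (⊛-cong yq^B (≈-refl {g₂})))
              (⊛-cong yq^C (≈-refl {g₃})) ⟩
  (1ₛ ⊕ Y ⊛ Y) ⊛ (q^ A ⊛ g₁) ⊕ (Y ⊛ q^ B) ⊛ g₂ ⊕ (Y ⊛ q^ C) ⊛ g₃
    ≈⟨ factor-out (1ₛ ⊕ Y ⊛ Y) Y (q^ A ⊛ g₁) (q^ B) (q^ C) g₂ g₃ ⟩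
  (1ₛ ⊕ Y ⊛ Y) ⊛ (q^ A ⊛ g₁) ⊕ Y ⊛ (q^ B ⊛ g₂ ⊕ q^ C ⊛ g₃)
    ∎
  where
  open ≈-Reasoning
  g₁ = gaussian (suc a) (suc b)
  g₂ = gaussian a (2 + b)
  g₃ = gaussian (2 + a) b
  distribute : ∀ x P R S g₁ g₂ g₃ →
    x ⊛ ((1ₛ ⊕ P) ⊛ g₁ ⊕ R ⊛ g₂ ⊕ S ⊛ g₃) ≈ (1ₛ ⊕ P) ⊛ (x ⊛ g₁) ⊕ (x ⊛ R) ⊛ g₂ ⊕ (x ⊛ S) ⊛ g₃
  distribute = solve 7 (λ x P R S g₁ g₂ g₃ → x :* ((con (+ 1) :+ P) :* g₁ :+ R :* g₂ :+ S :* g₃)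
                      := (con (+ 1) :+ P) :* (x :* g₁) :+ (x :* R) :* g₂ :+ (x :* S) :* g₃) ≈-refl
  factor-out : ∀ P Y t B C g₂ g₃ → P ⊛ t ⊕ (Y ⊛ B) ⊛ g₂ ⊕ (Y ⊛ C) ⊛ g₃ ≈ P ⊛ t ⊕ Y ⊛ (B ⊛ g₂ ⊕ C ⊛ g₃)
  factor-out = solve 7 (λ P Y t B C g₂ g₃ → P :* t :+ (Y :* B) :* g₂ :+ (Y :* C) :* g₃
                      := P :* t :+ Y :* (B :* g₂ :+ C :* g₃)) ≈-refl

-- For n = j + d this is q^{j²} [2n choose n - j]_{q²}; Gauss's finite form of
-- the triple product reads Σ_{|j| ≤ n} q^{j²} [2n choose n - j]_{q²} = ∏_{m ≤ n} (1 + q^{2m-1})².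
jacobiTerm : ℕ → ℕ → ℤ[[q]]
jacobiTerm j d = q^ (j * j) ⊛ gaussian (d + j + j) d

jacobiTerm-inner : ∀ j d → jacobiTerm (suc j) (2 + d) ≈
  (1ₛ ⊕ q^odd (2 + j + d) ⊛ q^odd (2 + j + d)) ⊛ jacobiTerm (suc j) (suc d)
  ⊕ q^odd (2 + j + d) ⊛ (jacobiTerm j (2 + d) ⊕ jacobiTerm (2 + j) d)
jacobiTerm-inner j d = begin
  q^ A ⊛ gaussian (2 + d + suc j + suc j) (2 + d)
    ≈⟨ ⊛-cong (≈-refl {q^ A}) (gaussian-cong (2 + d) (index₁ d j)) ⟩
  q^ A ⊛ gaussian (2 + a) (2 + d)
    ≈⟨ gaussian-step-shifted a d A B C Y (q²^⊛q²^-cong (2 + d) (suc a) n′ (exponent₁ d j))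
         (q^⊛q²^-cong A (2 + d) n′ B (exponent₂ d j)) (q^⊛q²^-cong A (2 + a) n′ C (exponent₃ d j)) ⟩
  (1ₛ ⊕ Y ⊛ Y) ⊛ (q^ A ⊛ gaussian (suc a) (suc d)) ⊕ Y ⊛ (q^ B ⊛ gaussian a (2 + d) ⊕ q^ C ⊛ gaussian (2 + a) d)
    ≈⟨ ⊕-cong (⊛-cong (≈-refl {1ₛ ⊕ Y ⊛ Y}) (⊛-cong (≈-refl {q^ A}) (gaussian-cong (suc d) (index₂ d j))))
              (⊛-cong (≈-refl {Y}) (⊕-cong (⊛-cong (≈-refl {q^ B}) (gaussian-cong (2 + d) (index₃ d j)))
                                           (⊛-cong (≈-refl {q^ C}) (gaussian-cong d (index₄ d j))))) ⟩
  (1ₛ ⊕ Y ⊛ Y) ⊛ jacobiTerm (suc j) (suc d) ⊕ Y ⊛ (jacobiTerm j (2 + d) ⊕ jacobiTerm (2 + j) d)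
    ∎
  where
  open ≈-Reasoning
  n′ = suc ((2 + j + d) + (2 + j + d))
  Y = q^odd (2 + j + d)
  A = suc j * suc j
  B = j * j
  C = (2 + j) * (2 + j)
  a = d + j + j + 2
  index₁ : ∀ d j → 2 + d + suc j + suc j ≡ 2 + (d + j + j + 2)
  index₁ = solve-ℕ
  index₂ : ∀ d j → suc (d + j + j + 2) ≡ suc d + suc j + suc j
  index₂ = solve-ℕ
  index₃ : ∀ d j → d + j + j + 2 ≡ 2 + d + j + j
  index₃ = solve-ℕ
  index₄ : ∀ d j → 2 + (d + j + j + 2) ≡ d + (2 + j) + (2 + j)
  index₄ = solve-ℕ
  exponent₁ : ∀ d j → 2 * (2 + d) + 2 * suc (d + j + j + 2) ≡ suc ((2 + j + d) + (2 + j + d)) + suc ((2 + j + d) + (2 + j + d))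
  exponent₁ = solve-ℕ
  exponent₂ : ∀ d j → suc j * suc j + 2 * (2 + d) ≡ suc ((2 + j + d) + (2 + j + d)) + j * j
  exponent₂ = solve-ℕ
  exponent₃ : ∀ d j → suc j * suc j + 2 * (2 + (d + j + j + 2)) ≡ suc ((2 + j + d) + (2 + j + d)) + (2 + j) * (2 + j)
  exponent₃ = solve-ℕ

jacobiTerm-edge : ∀ j → jacobiTerm (suc j) 1 ≈
  (1ₛ ⊕ q^odd (suc j) ⊛ q^odd (suc j)) ⊛ jacobiTerm (suc j) 0 ⊕ q^odd (suc j) ⊛ (jacobiTerm j 1 ⊕ 0ₛ)
jacobiTerm-edge j = begin
  q^ A ⊛ gaussian (1 + suc j + suc j) 1
    ≈⟨ ⊛-cong (≈-refl {q^ A}) (gaussian-cong 1 (index j)) ⟩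
  q^ A ⊛ gaussian (2 + a) 1
    ≈⟨ ⊛-cong (≈-refl {q^ A}) (gaussian-step₁ a) ⟩
  q^ A ⊛ ((1ₛ ⊕ q² ⊛^ (2 + a)) ⊕ q² ⊛^ 1 ⊛ gaussian a 1)
    ≈⟨ distribute (q^ A) (q² ⊛^ (2 + a)) (q² ⊛^ 1) (gaussian a 1) ⟩
  (1ₛ ⊕ q² ⊛^ (2 + a)) ⊛ (q^ A ⊛ 1ₛ) ⊕ (q^ A ⊛ q² ⊛^ 1) ⊛ gaussian a 1
    ≈⟨ ⊕-cong (⊛-cong (⊕-cong (≈-refl {1ₛ}) y²) (≈-refl {q^ A ⊛ 1ₛ})) (⊛-cong yq^B (≈-refl {gaussian a 1})) ⟩
  (1ₛ ⊕ Y ⊛ Y) ⊛ (q^ A ⊛ 1ₛ) ⊕ (Y ⊛ q^ B) ⊛ gaussian a 1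
    ≈⟨ factor-out (1ₛ ⊕ Y ⊛ Y) Y (q^ A ⊛ 1ₛ) (q^ B) (gaussian a 1) ⟩
  (1ₛ ⊕ Y ⊛ Y) ⊛ jacobiTerm (suc j) 0 ⊕ Y ⊛ (jacobiTerm j 1 ⊕ 0ₛ)
    ∎
  where
  open ≈-Reasoning
  Y = q^odd (suc j)
  A = suc j * suc j
  B = j * j
  a = suc (j + j)
  index : ∀ j → 1 + suc j + suc j ≡ 2 + suc (j + j)
  index = solve-ℕ
  exponent₁ : ∀ j → 2 * (2 + suc (j + j)) ≡ suc (suc j + suc j) + suc (suc j + suc j)
  exponent₁ = solve-ℕ
  exponent₂ : ∀ j → suc j * suc j + 2 * 1 ≡ suc (suc j + suc j) + j * j
  exponent₂ = solve-ℕ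
  y² : q² ⊛^ (2 + a) ≈ Y ⊛ Y
  y² = ≈-trans (q²^≈q^ (2 + a)) (≈-trans (q^-cong (exponent₁ j)) (q^-+ (suc (suc j + suc j)) (suc (suc j + suc j))))
  yq^B : q^ A ⊛ q² ⊛^ 1 ≈ Y ⊛ q^ B
  yq^B = q^⊛q²^-cong A 1 (suc (suc j + suc j)) B (exponent₂ j)
  distribute : ∀ x P R g → x ⊛ ((1ₛ ⊕ P) ⊕ R ⊛ g) ≈ (1ₛ ⊕ P) ⊛ (x ⊛ 1ₛ) ⊕ (x ⊛ R) ⊛ g
  distribute = solve 4 (λ x P R g → x :* ((con (+ 1) :+ P) :+ R :* g)
                      := (con (+ 1) :+ P) :* (x :* con (+ 1)) :+ (x :* R) :* g) ≈-refl
  factor-out : ∀ P Y t B g → P ⊛ t ⊕ (Y ⊛ B) ⊛ g ≈ P ⊛ t ⊕ Y ⊛ (B ⊛ g ⊕ 0ₛ)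
  factor-out = solve 5 (λ P Y t B g → P :* t :+ (Y :* B) :* g := P :* t :+ Y :* (B :* g :+ con (+ 0))) ≈-refl

jacobiTerm-top : ∀ n → jacobiTerm (suc n) 0 ≈
  (1ₛ ⊕ q^odd n ⊛ q^odd n) ⊛ 0ₛ ⊕ q^odd n ⊛ (jacobiTerm n 0 ⊕ 0ₛ)
jacobiTerm-top n =
  ≈-trans (⊛-cong (≈-trans (q^-cong (exponent n)) (q^-+ (suc (n + n)) (n * n))) (≈-refl {1ₛ}))
          (regroup (1ₛ ⊕ q^odd n ⊛ q^odd n) (q^odd n) (q^ (n * n)))
  where
  exponent : ∀ n → suc n * suc n ≡ suc (n + n) + n * n
  exponent = solve-ℕ
  regroup : ∀ P Y B → (Y ⊛ B) ⊛ 1ₛ ≈ P ⊛ 0ₛ ⊕ Y ⊛ (B ⊛ 1ₛ ⊕ 0ₛ)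
  regroup = solve 3 (λ P Y B → (Y :* B) :* con (+ 1) := P :* con (+ 0) :+ Y :* (B :* con (+ 1) :+ con (+ 0))) ≈-refl

jacobiTerm-centre : ∀ d → jacobiTerm 0 (2 + d) ≈
  (1ₛ ⊕ q^odd (suc d) ⊛ q^odd (suc d)) ⊛ jacobiTerm 0 (suc d) ⊕ q^odd (suc d) ⊛ (jacobiTerm 1 d ⊕ jacobiTerm 1 d)
jacobiTerm-centre d = begin
  q^ 0 ⊛ gaussian (2 + d + 0 + 0) (2 + d)
    ≈⟨ ⊛-cong (≈-refl {q^ 0}) (gaussian-cong (2 + d) (index₀ d)) ⟩
  q^ 0 ⊛ gaussian (2 + d) (2 + d)
    ≈⟨ gaussian-step-shifted d d 0 1 1 Y (q²^⊛q²^-cong (2 + d) (suc d) n′ (exponent₁ d))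
         (q^⊛q²^-cong 0 (2 + d) n′ 1 (exponent₂ d)) (q^⊛q²^-cong 0 (2 + d) n′ 1 (exponent₂ d)) ⟩
  (1ₛ ⊕ Y ⊛ Y) ⊛ (q^ 0 ⊛ gaussian (suc d) (suc d)) ⊕ Y ⊛ (q^ 1 ⊛ gaussian d (2 + d) ⊕ q^ 1 ⊛ gaussian (2 + d) d)
    ≈⟨ ⊕-cong (⊛-cong (≈-refl {1ₛ ⊕ Y ⊛ Y}) (⊛-cong (≈-refl {q^ 0}) (gaussian-cong (suc d) (sym (index₁ d)))))
              (⊛-cong (≈-refl {Y}) (⊕-cong (⊛-cong (≈-refl {q^ 1})
                                                    (≈-trans (gaussian-sym d (2 + d)) (gaussian-cong d (sym (index₂ d)))))
                                           (⊛-cong (≈-refl {q^ 1}) (gaussian-cong d (sym (index₂ d)))))) ⟩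
  (1ₛ ⊕ Y ⊛ Y) ⊛ jacobiTerm 0 (suc d) ⊕ Y ⊛ (jacobiTerm 1 d ⊕ jacobiTerm 1 d)
    ∎
  where
  open ≈-Reasoning
  n′ = suc (suc d + suc d)
  Y = q^odd (suc d)
  index₀ : ∀ d → 2 + d + 0 + 0 ≡ 2 + d
  index₀ = solve-ℕ
  index₁ : ∀ d → suc d + 0 + 0 ≡ suc d
  index₁ = solve-ℕ
  index₂ : ∀ d → d + 1 + 1 ≡ 2 + d
  index₂ = solve-ℕ
  exponent₁ : ∀ d → 2 * (2 + d) + 2 * suc d ≡ suc (suc d + suc d) + suc (suc d + suc d)
  exponent₁ = solve-ℕ
  exponent₂ : ∀ d → 0 + 2 * (2 + d) ≡ suc (suc d + suc d) + 1
  exponent₂ = solve-ℕ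

jacobiTerm-base : jacobiTerm 0 1 ≈ (1ₛ ⊕ q^odd 0 ⊛ q^odd 0) ⊛ jacobiTerm 0 0 ⊕ q^odd 0 ⊛ (0ₛ ⊕ 0ₛ)
jacobiTerm-base =
  ≈-trans (⊛-cong (≈-refl {1ₛ}) (⊕-cong (≈-refl {1ₛ}) (⊛-cong (⊛-cong (q^-+ 1 1) (≈-refl {1ₛ})) (≈-refl {1ₛ}))))
          (regroup (q^ 1))
  where
  regroup : ∀ x → 1ₛ ⊛ (1ₛ ⊕ ((x ⊛ x) ⊛ 1ₛ) ⊛ 1ₛ) ≈ (1ₛ ⊕ x ⊛ x) ⊛ (1ₛ ⊛ 1ₛ) ⊕ x ⊛ (0ₛ ⊕ 0ₛ)
  regroup = solve 1 (λ x → con (+ 1) :* (con (+ 1) :+ ((x :* x) :* con (+ 1)) :* con (+ 1))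
                        := (con (+ 1) :+ x :* x) :* (con (+ 1) :* con (+ 1)) :+ x :* (con (+ 0) :+ con (+ 0))) ≈-refl

delay : ℕ → (ℕ → ℤ[[q]]) → ℕ → ℤ[[q]]
delay zero    F n       = F n
delay (suc k) F zero    = 0ₛ
delay (suc k) F (suc n) = delay k F n

delay-at : ∀ k F d → delay k F (k + d) ≡ F d
delay-at zero    F d = refl
delay-at (suc k) F d = delay-at k F d

delay-below : ∀ k F {n} → n < k → delay k F n ≡ 0ₛ
delay-below (suc k) F {zero}  _         = refl
delay-below (suc k) F {suc n} (s≤s n<k) = delay-below k F n<k

jacobiCoeff : ℕ → ℕ → ℤ[[q]]
jacobiCoeff n j = delay j (jacobiTerm j) n

jacobiCoeff-at : ∀ {n} j d → n ≡ j + d → jacobiCoeff n j ≈ jacobiTerm j d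
jacobiCoeff-at j d refl = ≡⇒≈ (delay-at j (jacobiTerm j) d)

jacobiCoeff-beyond : ∀ {n j} → n < j → jacobiCoeff n j ≈ 0ₛ
jacobiCoeff-beyond {n} {j} n<j = ≡⇒≈ (delay-below j (jacobiTerm j) n<j)

data Range : ℕ → ℕ → Set where
  inner   : ∀ j d → Range (2 + j + d) j
  edge    : ∀ j → Range (suc j) j
  top     : ∀ j → Range j j
  beyond  : ∀ {n j} → n < j → Range n j

range : ∀ n j → Range n j
range zero          zero    = top 0
range zero          (suc j) = beyond (s≤s z≤n)
range (suc zero)    zero    = edge 0
range (suc (suc n)) zero    = inner 0 n
range (suc n)       (suc j) with range n j
... | inner j′ d  = inner (suc j′) d
... | edge j′     = edge (suc j′)
... | top j′      = top (suc j′)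
... | beyond n<j  = beyond (s≤s n<j)

JacobiRecurrence : ℕ → ℕ → Set
JacobiRecurrence n j = jacobiCoeff (suc n) (suc j) ≈
  (1ₛ ⊕ q^odd n ⊛ q^odd n) ⊛ jacobiCoeff n (suc j) ⊕ q^odd n ⊛ (jacobiCoeff n j ⊕ jacobiCoeff n (2 + j))

jacobiRecurrence-inner : ∀ j d → JacobiRecurrence (2 + j + d) j
jacobiRecurrence-inner j d = begin
  jacobiCoeff (3 + j + d) (suc j)
    ≈⟨ jacobiCoeff-at (suc j) (2 + d) (cong suc (2+j+d≡j+[2+d] j d)) ⟩
  jacobiTerm (suc j) (2 + d)
    ≈⟨ jacobiTerm-inner j d ⟩
  P ⊛ jacobiTerm (suc j) (suc d) ⊕ Y ⊛ (jacobiTerm j (2 + d) ⊕ jacobiTerm (2 + j) d)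
    ≈⟨ ⊕-cong (⊛-cong (≈-refl {P}) (jacobiCoeff-at (suc j) (suc d) (cong suc (sym (ℕₚ.+-suc j d)))))
              (⊛-cong (≈-refl {Y}) (⊕-cong (jacobiCoeff-at j (2 + d) (2+j+d≡j+[2+d] j d)) (jacobiCoeff-at (2 + j) d refl))) ⟨
  P ⊛ jacobiCoeff (2 + j + d) (suc j) ⊕ Y ⊛ (jacobiCoeff (2 + j + d) j ⊕ jacobiCoeff (2 + j + d) (2 + j))
    ∎
  where
  open ≈-Reasoning
  Y = q^odd (2 + j + d)
  P = 1ₛ ⊕ Y ⊛ Y
  2+j+d≡j+[2+d] : ∀ j d → 2 + j + d ≡ j + (2 + d)
  2+j+d≡j+[2+d] j d = trans (cong suc (sym (ℕₚ.+-suc j d))) (sym (ℕₚ.+-suc j (suc d)))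

jacobiRecurrence-edge : ∀ j → JacobiRecurrence (suc j) j
jacobiRecurrence-edge j = begin
  jacobiCoeff (2 + j) (suc j)
    ≈⟨ jacobiCoeff-at (suc j) 1 (ℕₚ.+-comm 1 (suc j)) ⟩
  jacobiTerm (suc j) 1
    ≈⟨ jacobiTerm-edge j ⟩
  P ⊛ jacobiTerm (suc j) 0 ⊕ Y ⊛ (jacobiTerm j 1 ⊕ 0ₛ)
    ≈⟨ ⊕-cong (⊛-cong (≈-refl {P}) (jacobiCoeff-at (suc j) 0 (sym (ℕₚ.+-identityʳ (suc j)))))
              (⊛-cong (≈-refl {Y}) (⊕-cong (jacobiCoeff-at j 1 (ℕₚ.+-comm 1 j)) (jacobiCoeff-beyond (ℕₚ.n<1+n (suc j))))) ⟨
  P ⊛ jacobiCoeff (suc j) (suc j) ⊕ Y ⊛ (jacobiCoeff (suc j) j ⊕ jacobiCoeff (suc j) (2 + j))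
    ∎
  where
  open ≈-Reasoning
  Y = q^odd (suc j)
  P = 1ₛ ⊕ Y ⊛ Y

jacobiRecurrence-top : ∀ j → JacobiRecurrence j j
jacobiRecurrence-top j = begin
  jacobiCoeff (suc j) (suc j)
    ≈⟨ jacobiCoeff-at (suc j) 0 (sym (ℕₚ.+-identityʳ (suc j))) ⟩
  jacobiTerm (suc j) 0
    ≈⟨ jacobiTerm-top j ⟩
  P ⊛ 0ₛ ⊕ Y ⊛ (jacobiTerm j 0 ⊕ 0ₛ)
    ≈⟨ ⊕-cong (⊛-cong (≈-refl {P}) (jacobiCoeff-beyond (ℕₚ.n<1+n j)))
              (⊛-cong (≈-refl {Y}) (⊕-cong (jacobiCoeff-at j 0 (sym (ℕₚ.+-identityʳ j)))
                                           (jacobiCoeff-beyond (ℕₚ.m<n⇒m<1+n (ℕₚ.n<1+n j))))) ⟨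
  P ⊛ jacobiCoeff j (suc j) ⊕ Y ⊛ (jacobiCoeff j j ⊕ jacobiCoeff j (2 + j))
    ∎
  where
  open ≈-Reasoning
  Y = q^odd j
  P = 1ₛ ⊕ Y ⊛ Y

jacobiRecurrence-beyond : ∀ {n j} → n < j → JacobiRecurrence n j
jacobiRecurrence-beyond {n} {j} n<j = begin
  jacobiCoeff (suc n) (suc j)
    ≈⟨ jacobiCoeff-beyond (s≤s n<j) ⟩
  0ₛ
    ≈⟨ solve 2 (λ P Y → P :* con (+ 0) :+ Y :* (con (+ 0) :+ con (+ 0)) := con (+ 0)) ≈-refl P Y ⟨
  P ⊛ 0ₛ ⊕ Y ⊛ (0ₛ ⊕ 0ₛ)
    ≈⟨ ⊕-cong (⊛-cong (≈-refl {P}) (jacobiCoeff-beyond (ℕₚ.m<n⇒m<1+n n<j)))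
              (⊛-cong (≈-refl {Y}) (⊕-cong (jacobiCoeff-beyond n<j) (jacobiCoeff-beyond (ℕₚ.m<n⇒m<1+n (ℕₚ.m<n⇒m<1+n n<j))))) ⟨
  P ⊛ jacobiCoeff n (suc j) ⊕ Y ⊛ (jacobiCoeff n j ⊕ jacobiCoeff n (2 + j))
    ∎
  where
  open ≈-Reasoning
  Y = q^odd n
  P = 1ₛ ⊕ Y ⊛ Y

jacobiCoeff-rec : ∀ n j → JacobiRecurrence n j
jacobiCoeff-rec n j with range n j
... | inner j d  = jacobiRecurrence-inner j d
... | edge j     = jacobiRecurrence-edge j
... | top j      = jacobiRecurrence-top j
... | beyond n<j = jacobiRecurrence-beyond n<j

jacobiCoeff-rec₀ : ∀ n → jacobiCoeff (suc n) 0 ≈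
  (1ₛ ⊕ q^odd n ⊛ q^odd n) ⊛ jacobiCoeff n 0 ⊕ q^odd n ⊛ (jacobiCoeff n 1 ⊕ jacobiCoeff n 1)
jacobiCoeff-rec₀ zero    =
  ≈-trans jacobiTerm-base
          (⊕-cong (≈-refl {(1ₛ ⊕ q^odd 0 ⊛ q^odd 0) ⊛ jacobiCoeff 0 0})
                  (⊛-cong (≈-refl {q^odd 0}) (⊕-cong (≈-sym J₀₁≈0) (≈-sym J₀₁≈0))))
  where
  J₀₁≈0 : jacobiCoeff 0 1 ≈ 0ₛ
  J₀₁≈0 = jacobiCoeff-beyond {0} {1} (s≤s z≤n)
jacobiCoeff-rec₀ (suc d) =
  ≈-trans (jacobiTerm-centre d)
          (⊕-cong (≈-refl {(1ₛ ⊕ q^odd (suc d) ⊛ q^odd (suc d)) ⊛ jacobiCoeff (suc d) 0})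
                  (⊛-cong (≈-refl {q^odd (suc d)}) (⊕-cong (≈-sym (jacobiCoeff-at 1 d refl)) (≈-sym (jacobiCoeff-at 1 d refl)))))

jacobiPartial : ℕ → ℕ → ℤ[[q]]
jacobiPartial n zero    = 0ₛ
jacobiPartial n (suc K) = jacobiPartial n K ⊕ jacobiCoeff n (suc K)

jacobiSum : ℕ → ℤ[[q]]
jacobiSum n = jacobiCoeff n 0 ⊕ (jacobiPartial n (suc n) ⊕ jacobiPartial n (suc n))

move-right : ∀ a b {c} → a ⊕ b ≈ c → a ≈ c ⊕ ⊝ b
move-right a b a+b≈c =
  ≈-trans (solve 2 (λ a b → a := (a :+ b) :+ :- b) ≈-refl a b) (⊕-cong a+b≈c (≈-refl {⊝ b}))

jacobiPartial-rec : ∀ n K →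
  jacobiPartial (suc n) K ⊕ q^odd n ⊛ (jacobiCoeff n K ⊕ jacobiCoeff n 1) ≈
  (1ₛ ⊕ q^odd n ⊛ q^odd n) ⊛ jacobiPartial n K
  ⊕ q^odd n ⊛ (jacobiCoeff n 0 ⊕ (jacobiPartial n K ⊕ jacobiPartial n K) ⊕ jacobiCoeff n (suc K))
jacobiPartial-rec n zero    =
  solve 4 (λ P Y a b → con (+ 0) :+ Y :* (a :+ b) := P :* con (+ 0) :+ Y :* (a :+ (con (+ 0) :+ con (+ 0)) :+ b)) ≈-refl
    (1ₛ ⊕ q^odd n ⊛ q^odd n) (q^odd n) (jacobiCoeff n 0) (jacobiCoeff n 1)
jacobiPartial-rec n (suc K) = begin
  (jacobiPartial (suc n) K ⊕ jacobiCoeff (suc n) (suc K)) ⊕ Y ⊛ (J (suc K) ⊕ J 1)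
    ≈⟨ ⊕-cong (⊕-cong (move-right (jacobiPartial (suc n) K) (Y ⊛ (J K ⊕ J 1)) (jacobiPartial-rec n K))
                      (jacobiCoeff-rec n K))
              (≈-refl {Y ⊛ (J (suc K) ⊕ J 1)}) ⟩
  ((P ⊛ S ⊕ Y ⊛ (J 0 ⊕ (S ⊕ S) ⊕ J (suc K))) ⊕ ⊝ (Y ⊛ (J K ⊕ J 1)))
    ⊕ (P ⊛ J (suc K) ⊕ Y ⊛ (J K ⊕ J (2 + K))) ⊕ Y ⊛ (J (suc K) ⊕ J 1)
    ≈⟨ regroup P Y S (J 0) (J 1) (J K) (J (suc K)) (J (2 + K)) ⟩
  P ⊛ (S ⊕ J (suc K)) ⊕ Y ⊛ (J 0 ⊕ ((S ⊕ J (suc K)) ⊕ (S ⊕ J (suc K))) ⊕ J (2 + K))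
    ∎
  where
  open ≈-Reasoning
  Y = q^odd n
  P = 1ₛ ⊕ q^odd n ⊛ q^odd n
  J = jacobiCoeff n
  S = jacobiPartial n K
  regroup : ∀ P Y s u₀ u₁ u u′ u″ →
    ((P ⊛ s ⊕ Y ⊛ (u₀ ⊕ (s ⊕ s) ⊕ u′)) ⊕ ⊝ (Y ⊛ (u ⊕ u₁)))
      ⊕ (P ⊛ u′ ⊕ Y ⊛ (u ⊕ u″)) ⊕ Y ⊛ (u′ ⊕ u₁)
    ≈ P ⊛ (s ⊕ u′) ⊕ Y ⊛ (u₀ ⊕ ((s ⊕ u′) ⊕ (s ⊕ u′)) ⊕ u″)
  regroup = solve 8 (λ P Y s u₀ u₁ u u′ u″ →
    ((P :* s :+ Y :* (u₀ :+ (s :+ s) :+ u′)) :+ :- (Y :* (u :+ u₁))) :+ (P :* u′ :+ Y :* (u :+ u″)) :+ Y :* (u′ :+ u₁)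
    := P :* (s :+ u′) :+ Y :* (u₀ :+ ((s :+ u′) :+ (s :+ u′)) :+ u″)) ≈-refl

jacobiSum-rec : ∀ n → jacobiSum (suc n) ≈ ((1ₛ ⊕ q^odd n) ⊛ (1ₛ ⊕ q^odd n)) ⊛ jacobiSum n
jacobiSum-rec n = begin
  jacobiCoeff (suc n) 0 ⊕ (jacobiPartial (suc n) (2 + n) ⊕ jacobiPartial (suc n) (2 + n))
    ≈⟨ ⊕-cong (jacobiCoeff-rec₀ n) (⊕-cong S′≈ S′≈) ⟩
  (P ⊛ J 0 ⊕ Y ⊛ (J 1 ⊕ J 1)) ⊕ (T ⊕ T)
    ≈⟨ regroup Y (J 0) (J 1) S ⟩
  ((1ₛ ⊕ Y) ⊛ (1ₛ ⊕ Y)) ⊛ jacobiSum n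
    ∎
  where
  open ≈-Reasoning
  Y = q^odd n
  P = 1ₛ ⊕ q^odd n ⊛ q^odd n
  J = jacobiCoeff n
  S = jacobiPartial n (suc n)
  T = (P ⊛ S ⊕ Y ⊛ (J 0 ⊕ (S ⊕ S) ⊕ 0ₛ)) ⊕ ⊝ (Y ⊛ (0ₛ ⊕ J 1))
  S′≈ : jacobiPartial (suc n) (2 + n) ≈ T
  S′≈ = begin
    jacobiPartial (suc n) (suc n) ⊕ jacobiCoeff (suc n) (2 + n)
      ≈⟨ ⊕-cong (≈-refl {jacobiPartial (suc n) (suc n)}) (jacobiCoeff-beyond (ℕₚ.n<1+n (suc n))) ⟩
    jacobiPartial (suc n) (suc n) ⊕ 0ₛ
      ≈⟨ ⊕-identityʳ _ ⟩
    jacobiPartial (suc n) (suc n)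
      ≈⟨ move-right (jacobiPartial (suc n) (suc n)) (Y ⊛ (J (suc n) ⊕ J 1)) (jacobiPartial-rec n (suc n)) ⟩
    (P ⊛ S ⊕ Y ⊛ (J 0 ⊕ (S ⊕ S) ⊕ J (2 + n))) ⊕ ⊝ (Y ⊛ (J (suc n) ⊕ J 1))
      ≈⟨ ⊕-cong (⊕-cong (≈-refl {P ⊛ S}) (⊛-cong (≈-refl {Y}) (⊕-cong (≈-refl {J 0 ⊕ (S ⊕ S)})
                  (jacobiCoeff-beyond (ℕₚ.m<n⇒m<1+n (ℕₚ.n<1+n n))))))
                (⊝-cong (⊛-cong (≈-refl {Y}) (⊕-cong (jacobiCoeff-beyond (ℕₚ.n<1+n n)) (≈-refl {J 1})))) ⟩
    T ∎
  regroup : ∀ Y u₀ u₁ s → ((1ₛ ⊕ Y ⊛ Y) ⊛ u₀ ⊕ Y ⊛ (u₁ ⊕ u₁)) ⊕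
      ((((1ₛ ⊕ Y ⊛ Y) ⊛ s ⊕ Y ⊛ (u₀ ⊕ (s ⊕ s) ⊕ 0ₛ)) ⊕ ⊝ (Y ⊛ (0ₛ ⊕ u₁)))
       ⊕ (((1ₛ ⊕ Y ⊛ Y) ⊛ s ⊕ Y ⊛ (u₀ ⊕ (s ⊕ s) ⊕ 0ₛ)) ⊕ ⊝ (Y ⊛ (0ₛ ⊕ u₁))))
    ≈ ((1ₛ ⊕ Y) ⊛ (1ₛ ⊕ Y)) ⊛ (u₀ ⊕ (s ⊕ s))
  regroup = solve 4 (λ Y u₀ u₁ s → ((con (+ 1) :+ Y :* Y) :* u₀ :+ Y :* (u₁ :+ u₁)) :+
      ((((con (+ 1) :+ Y :* Y) :* s :+ Y :* (u₀ :+ (s :+ s) :+ con (+ 0))) :+ :- (Y :* (con (+ 0) :+ u₁)))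
       :+ (((con (+ 1) :+ Y :* Y) :* s :+ Y :* (u₀ :+ (s :+ s) :+ con (+ 0))) :+ :- (Y :* (con (+ 0) :+ u₁))))
    := ((con (+ 1) :+ Y) :* (con (+ 1) :+ Y)) :* (u₀ :+ (s :+ s))) ≈-refl

∏odd : (ℕ → ℤ[[q]]) → ℕ → ℤ[[q]]
∏odd F zero    = 1ₛ
∏odd F (suc n) = F (suc (n + n)) ⊛ ∏odd F n

jacobiSum≈∏odd-onePlus² : ∀ n → jacobiSum n ≈ ∏odd onePlus n ⊛ ∏odd onePlus n
jacobiSum≈∏odd-onePlus² zero    =
  solve 0 (con (+ 1) :* con (+ 1) :+ ((con (+ 0) :+ con (+ 0)) :+ (con (+ 0) :+ con (+ 0))) := con (+ 1) :* con (+ 1)) ≈-refl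
jacobiSum≈∏odd-onePlus² (suc n) =
  ≈-trans (jacobiSum-rec n)
    (≈-trans (⊛-cong (≈-refl {(1ₛ ⊕ q^odd n) ⊛ (1ₛ ⊕ q^odd n)}) (jacobiSum≈∏odd-onePlus² n))
             (solve 2 (λ a b → (a :* a) :* (b :* b) := (a :* b) :* (a :* b)) ≈-refl (1ₛ ⊕ q^odd n) (∏odd onePlus n)))

-- Truncations of Jacobi's and Euler's identities
geometric≈[]1 : ∀ m → 1 ≤ m → geometric m ≈[ m ] 1ₛ
geometric≈[]1 m 1≤m = ≈[]-trans (≈⇒≈[] m (geometric-rec m 1≤m)) (1⊕q^⊛≈[]1 m (geometric m))

evenPartitions : ℕ → ℤ[[q]]
evenPartitions = ∏ (λ k → geometric (2 * k))

evenPartitions-rec : ∀ b → evenPartitions (suc b) ≈ evenPartitions b ⊕ q² ⊛^ suc b ⊛ evenPartitions (suc b)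
evenPartitions-rec b = begin
  geometric (2 * suc b) ⊛ evenPartitions b
    ≈⟨ ⊛-cong (geometric-rec (2 * suc b) (s≤s z≤n)) (≈-refl {evenPartitions b}) ⟩
  (1ₛ ⊕ q^ (2 * suc b) ⊛ geometric (2 * suc b)) ⊛ evenPartitions b
    ≈⟨ solve 3 (λ x g e → (con (+ 1) :+ x :* g) :* e := e :+ x :* (g :* e)) ≈-refl _ _ _ ⟩
  evenPartitions b ⊕ q^ (2 * suc b) ⊛ evenPartitions (suc b)
    ≈⟨ ⊕-cong (≈-refl {evenPartitions b}) (⊛-cong (≈-sym (q²^≈q^ (suc b))) (≈-refl {evenPartitions (suc b)})) ⟩
  evenPartitions b ⊕ q² ⊛^ suc b ⊛ evenPartitions (suc b)
    ∎
  where open ≈-Reasoning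

evenPartitions≈[]1 : ∀ b → evenPartitions b ≈[ 2 ] 1ₛ
evenPartitions≈[]1 zero    = ≈[]-refl
evenPartitions≈[]1 (suc b) =
  ≈[]-trans (≈[]1⇒⊛≈[] (≈[]-mono (ℕₚ.*-monoʳ-≤ 2 (s≤s (z≤n {b}))) (geometric≈[]1 (2 * suc b) (s≤s z≤n))))
            (evenPartitions≈[]1 b)

q²^⊛-cong[] : ∀ k {f g M} → f ≈[ M ] g → q² ⊛^ k ⊛ f ≈[ 2 * k + M ] q² ⊛^ k ⊛ g
q²^⊛-cong[] k {f} {g} f≈g = ≈[]-respects-≈ (⊛-cong (≈-sym (q²^≈q^ k)) (≈-refl {f}))
  (⊛-cong (≈-sym (q²^≈q^ k)) (≈-refl {g})) (q^⊛-cong[] (2 * k) f≈g)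

gaussian-limit : ∀ a b → gaussian a b ≈[ 2 + a + a ] evenPartitions b
gaussian-limit a       zero    = ≈[]-refl
gaussian-limit zero    (suc b) = ≈[]-sym (evenPartitions≈[]1 (suc b))
gaussian-limit (suc a) (suc b) = ≈[]-trans
  (⊕-cong[] (gaussian-limit (suc a) b) (≈[]-mono bound (q²^⊛-cong[] (suc b) (gaussian-limit a (suc b)))))
  (≈[]-sym (≈⇒≈[] _ (evenPartitions-rec b)))
  where
  2+2a≡ : ∀ a → 2 + suc a + suc a ≡ 2 * 1 + (2 + a + a)
  2+2a≡ = solve-ℕ
  bound : 2 + suc a + suc a ≤ 2 * suc b + (2 + a + a)
  bound = ℕₚ.≤-trans (ℕₚ.≤-reflexive (2+2a≡ a)) (ℕₚ.+-monoˡ-≤ (2 + a + a) (ℕₚ.*-monoʳ-≤ 2 (s≤s z≤n)))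

evenPartitions-stable : ∀ b k → evenPartitions (k + b) ≈[ 2 + b + b ] evenPartitions b
evenPartitions-stable b = ∏-extend _ _ b factor≈1
  where
  factor≈1 : ∀ m → b < m → geometric (2 * m) ≈[ 2 + b + b ] 1ₛ
  factor≈1 m@(suc _) b<m = ≈[]-mono bound (geometric≈[]1 (2 * m) (s≤s z≤n))
    where
    bound : 2 + b + b ≤ 2 * m
    bound = ℕₚ.≤-trans (ℕₚ.≤-reflexive (cong suc (sym (ℕₚ.+-suc b b))))
                       (ℕₚ.≤-trans (ℕₚ.+-mono-≤ b<m b<m) (ℕₚ.≤-reflexive (sym (2*k≡k+k m))))

jacobiTerm-limit : ∀ j d → jacobiTerm j d ≈[ suc (2 * (j + d)) ] q^ (j * j) ⊛ evenPartitions (j + d)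
jacobiTerm-limit j d = ≈[]-mono (bound j d) (q^⊛-cong[] (j * j) gaussian≈)
  where
  gaussian≈ : gaussian (d + j + j) d ≈[ 2 + d + d ] evenPartitions (j + d)
  gaussian≈ = ≈[]-trans (≈[]-mono (s≤s (s≤s (ℕₚ.+-mono-≤ d≤ d≤))) (gaussian-limit (d + j + j) d))
                        (≈[]-sym (evenPartitions-stable d j))
    where
    d≤ : d ≤ d + j + j
    d≤ = ℕₚ.≤-trans (ℕₚ.m≤m+n d j) (ℕₚ.m≤m+n (d + j) j)
  bound : ∀ j d → suc (2 * (j + d)) ≤ j * j + (2 + d + d)
  bound zero    d = ℕₚ.≤-trans (ℕₚ.≤-reflexive (rearrange₀ d)) (ℕₚ.n≤1+n _)
    where
    rearrange₀ : ∀ d → suc (2 * (0 + d)) ≡ 1 + d + d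
    rearrange₀ = solve-ℕ
  bound (suc j) d = ℕₚ.≤-trans (ℕₚ.m≤m+n _ (j * j)) (ℕₚ.≤-reflexive (rearrange j d))
    where
    rearrange : ∀ j d → suc (2 * (suc j + d)) + j * j ≡ suc j * suc j + (2 + d + d)
    rearrange = solve-ℕ

squares : ℕ → ℤ[[q]]
squares zero    = 0ₛ
squares (suc K) = squares K ⊕ q^ (suc K * suc K)

-- theta n = Σ_{|j| ≤ n} q^{j²}.
theta : ℕ → ℤ[[q]]
theta n = 1ₛ ⊕ (squares n ⊕ squares n)

jacobiCoeff-limit : ∀ n j → j ≤ n → jacobiCoeff n j ≈[ suc (2 * n) ] q^ (j * j) ⊛ evenPartitions n
jacobiCoeff-limit n j j≤n with ℕₚ.m≤n⇒∃[o]m+o≡n j≤n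
... | d , refl = ≈[]-trans (≈⇒≈[] _ (jacobiCoeff-at j d refl)) (jacobiTerm-limit j d)

jacobiPartial-limit : ∀ n K → K ≤ n → jacobiPartial n K ≈[ suc (2 * n) ] squares K ⊛ evenPartitions n
jacobiPartial-limit n zero    _   = ≈[]-sym (≈⇒≈[] _ (⊛-zeroˡ-pointwise 0ₛ (evenPartitions n) const-0))
jacobiPartial-limit n (suc K) K<n =
  ≈[]-trans (⊕-cong[] (jacobiPartial-limit n K (ℕₚ.<⇒≤ K<n)) (jacobiCoeff-limit n (suc K) K<n))
            (≈⇒≈[] _ (≈-sym (⊛-distribʳ-⊕ (squares K) (q^ (suc K * suc K)) (evenPartitions n))))

jacobiSum-limit : ∀ n → jacobiSum n ≈[ suc (2 * n) ] theta n ⊛ evenPartitions n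
jacobiSum-limit n =
  ≈[]-trans (⊕-cong[] (jacobiCoeff-limit n 0 z≤n) (⊕-cong[] partial partial))
            (≈⇒≈[] _ (regroup (evenPartitions n) (squares n)))
  where
  partial : jacobiPartial n (suc n) ≈[ suc (2 * n) ] squares n ⊛ evenPartitions n ⊕ 0ₛ
  partial = ⊕-cong[] (jacobiPartial-limit n n ℕₚ.≤-refl) (≈⇒≈[] _ (jacobiCoeff-beyond (ℕₚ.n<1+n n)))
  regroup : ∀ e t → 1ₛ ⊛ e ⊕ ((t ⊛ e ⊕ 0ₛ) ⊕ (t ⊛ e ⊕ 0ₛ)) ≈ (1ₛ ⊕ (t ⊕ t)) ⊛ e
  regroup = solve 2 (λ e t → con (+ 1) :* e :+ ((t :* e :+ con (+ 0)) :+ (t :* e :+ con (+ 0)))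
                          := (con (+ 1) :+ (t :+ t)) :* e) ≈-refl

∏odd-onePlus²≈[]theta⊛evenPartitions : ∀ n → ∏odd onePlus n ⊛ ∏odd onePlus n ≈[ suc (2 * n) ] theta n ⊛ evenPartitions n
∏odd-onePlus²≈[]theta⊛evenPartitions n = ≈[]-trans (≈⇒≈[] _ (≈-sym (jacobiSum≈∏odd-onePlus² n))) (jacobiSum-limit n)

isEven : ℕ → Bool
isEven m = m % 2 ≡ᵇ 0

_==_ : Bool → Bool → Bool
true  == b = b
false == b = not b

isEven-suc : ∀ n → isEven (suc n) ≡ not (isEven n)
isEven-suc zero          = refl
isEven-suc (suc zero)    = refl
isEven-suc (suc (suc n)) = isEven-suc n

isEven-+ : ∀ m n → isEven (m + n) ≡ isEven m == isEven n
isEven-+ zero    n = refl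
isEven-+ (suc m) n = begin
  isEven (suc (m + n))          ≡⟨ isEven-suc (m + n) ⟩
  not (isEven (m + n))          ≡⟨ cong not (isEven-+ m n) ⟩
  not (isEven m == isEven n)    ≡⟨ not-== (isEven m) (isEven n) ⟩
  not (isEven m) == isEven n    ≡⟨ cong (_== isEven n) (sym (isEven-suc m)) ⟩
  isEven (suc m) == isEven n    ∎
  where
  open ≡-Reasoning
  not-== : ∀ a b → not (a == b) ≡ not a == b
  not-== true  b = refl
  not-== false b = not-involutive b

isEven-double : ∀ n → isEven (n + n) ≡ true
isEven-double zero    = refl
isEven-double (suc n) = trans (cong isEven (cong suc (ℕₚ.+-suc n n))) (isEven-double n)

isEven-odd : ∀ n → isEven (suc (n + n)) ≡ false
isEven-odd zero    = refl
isEven-odd (suc n) = trans (cong isEven (cong (suc ∘ suc) (ℕₚ.+-suc n n))) (isEven-odd n)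

isEven-+2* : ∀ a m → isEven (a + m * 2) ≡ isEven a
isEven-+2* a m = cong (_≡ᵇ 0) ([m+kn]%n≡m%n a m 2)

odd-2n+1 : ∀ n → isEven (2 * n + 1) ≡ false
odd-2n+1 n = trans (cong isEven (trans (ℕₚ.+-comm (2 * n) 1) (cong suc (ℕₚ.*-comm 2 n)))) (isEven-+2* 1 n)

odd-4n+3 : ∀ n → isEven (4 * n + 3) ≡ false
odd-4n+3 n = trans (cong isEven (rearrange n)) (isEven-+2* 3 (2 * n))
  where
  rearrange : ∀ n → 4 * n + 3 ≡ 3 + 2 * n * 2
  rearrange = solve-ℕ

odd-8n+5 : ∀ n → isEven (8 * n + 5) ≡ false
odd-8n+5 n = trans (cong isEven (rearrange n)) (isEven-+2* 5 (4 * n))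
  where
  rearrange : ∀ n → 8 * n + 5 ≡ 5 + 4 * n * 2
  rearrange = solve-ℕ

-- Splitting the product by parity of the part sizes
oddPart evenPart : (ℕ → ℤ[[q]]) → ℕ → ℤ[[q]]
oddPart  F m = if isEven m then 1ₛ else F m
evenPart F m = if isEven m then F m else 1ₛ

coloured-split : ∀ r s m → coloured r s m ≈ oddPart overpartFactor m ⊛^ s ⊛ evenPart overpartFactor m ⊛^ r
coloured-split r s m with isEven m
... | true  = ≈-sym (≈-trans (⊛-cong (1ₛ⊛^ s) ≈-refl) (⊛-identityˡ _))
... | false = ≈-sym (≈-trans (⊛-cong ≈-refl (1ₛ⊛^ r)) (≈-trans (⊛-comm _ 1ₛ) (⊛-identityˡ _)))

∏-coloured-split : ∀ r s N →
  ∏ (coloured r s) N ≈ ∏ (oddPart overpartFactor) N ⊛^ s ⊛ ∏ (evenPart overpartFactor) N ⊛^ r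
∏-coloured-split r s N = begin
  ∏ (coloured r s) N
    ≈⟨ ∏-cong N (λ m → coloured-split r s (suc m)) ⟩
  ∏ (λ m → oddPart overpartFactor m ⊛^ s ⊛ evenPart overpartFactor m ⊛^ r) N
    ≈⟨ ∏-⊛ (λ m → oddPart overpartFactor m ⊛^ s) (λ m → evenPart overpartFactor m ⊛^ r) N ⟩
  ∏ (λ m → oddPart overpartFactor m ⊛^ s) N ⊛ ∏ (λ m → evenPart overpartFactor m ⊛^ r) N
    ≈⟨ ⊛-cong (∏-⊛^ (oddPart overpartFactor) s N) (∏-⊛^ (evenPart overpartFactor) r N) ⟩
  ∏ (oddPart overpartFactor) N ⊛^ s ⊛ ∏ (evenPart overpartFactor) N ⊛^ r
    ∎
  where open ≈-Reasoning

∏-oddPart-double : ∀ F n → ∏ (oddPart F) (n + n) ≈ ∏odd F n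
∏-oddPart-double F zero    = ≈-refl
∏-oddPart-double F (suc n) rewrite ℕₚ.+-suc n n | isEven-double n | isEven-odd n =
  ≈-trans (⊛-identityˡ _) (⊛-cong (≈-refl {F (suc (n + n))}) (∏-oddPart-double F n))

∏-evenPart-double : ∀ F n → ∏ (evenPart F) (n + n) ≈ ∏ (λ k → F (k + k)) n
∏-evenPart-double F zero    = ≈-refl
∏-evenPart-double F (suc n) rewrite ℕₚ.+-suc n n | isEven-double n | isEven-odd n =
  ⊛-cong (≈-refl {F (2 + (n + n))}) (≈-trans (⊛-identityˡ _) (∏-evenPart-double F n))

geometric-split : ∀ m → 1 ≤ m → geometric m ≈ onePlus m ⊛ geometric (2 * m)
geometric-split m 1≤m =
  ≈-sym (≈-trans (⊛-inverse-solve (oneMinus⊛geometric m 1≤m) product≈1) (⊛-identityʳ (geometric m)))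
  where
  open ≈-Reasoning
  difference-of-squares : oneMinus m ⊛ onePlus m ≈ oneMinus (2 * m)
  difference-of-squares =
    ≈-trans (solve 1 (λ x → (con (+ 1) :+ :- x) :* (con (+ 1) :+ x) := con (+ 1) :+ :- (x :* x)) ≈-refl (q^ m))
            (⊕-cong (≈-refl {1ₛ}) (⊝-cong (≈-sym (≈-trans (q^-cong (2*k≡k+k m)) (q^-+ m m)))))
  product≈1 : oneMinus m ⊛ (onePlus m ⊛ geometric (2 * m)) ≈ 1ₛ
  product≈1 = begin
    oneMinus m ⊛ (onePlus m ⊛ geometric (2 * m))   ≈⟨ ⊛-assoc (oneMinus m) (onePlus m) _ ⟨
    (oneMinus m ⊛ onePlus m) ⊛ geometric (2 * m)   ≈⟨ ⊛-cong difference-of-squares (≈-refl {geometric (2 * m)}) ⟩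
    oneMinus (2 * m) ⊛ geometric (2 * m)           ≈⟨ oneMinus⊛geometric (2 * m) (ℕₚ.≤-trans 1≤m (ℕₚ.m≤m+n m (m + 0))) ⟩
    1ₛ                                              ∎

⊛-cancelʳ-≈[] : ∀ {A B u v M} → A ⊛ u ≈[ M ] B ⊛ u → u ⊛ v ≈ 1ₛ → A ≈[ M ] B
⊛-cancelʳ-≈[] {A} {B} {u} {v} {M} Au≈Bu uv≈1 =
  ≈[]-respects-≈ (cancel A) (cancel B) (⊛-cong[] Au≈Bu (≈[]-refl {v}))
  where
  cancel : ∀ X → (X ⊛ u) ⊛ v ≈ X
  cancel X = ≈-trans (⊛-assoc X u v) (≈-trans (⊛-cong (≈-refl {X}) uv≈1) (⊛-identityʳ X))

euler-odd-distinct : ∀ K →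
  ∏ (oddPart (λ m → geometric (2 * m))) (K + K) ≈[ 2 + K + K ] ∏ (λ k → onePlus (2 * k)) K
euler-odd-distinct K = ⊛-cancelʳ-≈[] {u = U} {v = U⁻¹} truncated U⊛U⁻¹≈1
  where
  4k : ℕ → ℕ
  4k k = 2 * (k + k)
  U U⁻¹ : ℤ[[q]]
  U   = ∏ (λ k → geometric (4k k)) K
  U⁻¹ = ∏ (λ k → oneMinus (4k k)) K
  U⊛U⁻¹≈1 : U ⊛ U⁻¹ ≈ 1ₛ
  U⊛U⁻¹≈1 = ≈-trans (≈-sym (∏-⊛ (λ k → geometric (4k k)) (λ k → oneMinus (4k k)) K))
    (∏-1 K (λ k → ≈-trans (⊛-comm _ _) (oneMinus⊛geometric (4k (suc k)) (s≤s z≤n))))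
  evenPartitions-split : evenPartitions K ≈ ∏ (λ k → onePlus (2 * k)) K ⊛ U
  evenPartitions-split = ≈-trans
    (∏-cong K (λ k → ≈-trans (geometric-split (2 * suc k) (s≤s z≤n))
                             (⊛-cong (≈-refl {onePlus (2 * suc k)}) (≡⇒≈ (cong geometric (cong (2 *_) (2*k≡k+k (suc k))))))))
    (∏-⊛ (λ k → onePlus (2 * k)) (λ k → geometric (4k k)) K)
  evenPartitions-parity-split : evenPartitions (K + K) ≈ ∏ (oddPart (λ m → geometric (2 * m))) (K + K) ⊛ U
  evenPartitions-parity-split = ≈-trans (∏-cong (K + K) (λ m → by-parity (suc m)))
    (≈-trans (∏-⊛ (oddPart G) (evenPart G) (K + K))
             (⊛-cong (≈-refl {∏ (oddPart G) (K + K)}) (∏-evenPart-double G K)))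
    where
    G = λ m → geometric (2 * m)
    by-parity : ∀ m → G m ≈ oddPart G m ⊛ evenPart G m
    by-parity m with isEven m
    ... | true  = ≈-sym (⊛-identityˡ (G m))
    ... | false = ≈-sym (⊛-identityʳ (G m))
  truncated : ∏ (oddPart (λ m → geometric (2 * m))) (K + K) ⊛ U ≈[ 2 + K + K ] ∏ (λ k → onePlus (2 * k)) K ⊛ U
  truncated = ≈[]-respects-≈ evenPartitions-parity-split evenPartitions-split (evenPartitions-stable K K)

oddPart≈[]1 : ∀ F {M} m → F m ≈[ M ] 1ₛ → oddPart F m ≈[ M ] 1ₛ
oddPart≈[]1 F m Fm≈1 with isEven m
... | true  = ≈[]-refl
... | false = Fm≈1

evenPart≈[]1 : ∀ F {M} m → F m ≈[ M ] 1ₛ → evenPart F m ≈[ M ] 1ₛ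
evenPart≈[]1 F m Fm≈1 with isEven m
... | true  = Fm≈1
... | false = ≈[]-refl

onePlus≈[]1 : ∀ m → onePlus m ≈[ m ] 1ₛ
onePlus≈[]1 m = ≈[]-respects-≈ (⊕-cong (≈-refl {1ₛ}) (⊛-identityʳ (q^ m))) ≈-refl (1⊕q^⊛≈[]1 m 1ₛ)

overpartFactor≈[]1 : ∀ m → 1 ≤ m → overpartFactor m ≈[ m ] 1ₛ
overpartFactor≈[]1 m 1≤m =
  ≈[]-trans (⊛-cong[] (onePlus≈[]1 m) (geometric≈[]1 m 1≤m)) (≈⇒≈[] m (⊛-identityˡ 1ₛ))

∏-oddPart-overpartFactor : ∀ N → ∏ (oddPart overpartFactor) N ≈
  (∏ (oddPart onePlus) N ⊛ ∏ (oddPart onePlus) N) ⊛ ∏ (oddPart (λ m → geometric (2 * m))) N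
∏-oddPart-overpartFactor N = begin
  ∏ (oddPart overpartFactor) N
    ≈⟨ ∏-cong N (λ m → factor-split (suc m) (s≤s z≤n)) ⟩
  ∏ (λ m → (oddPart onePlus m ⊛ oddPart onePlus m) ⊛ oddPart G m) N
    ≈⟨ ∏-⊛ (λ m → oddPart onePlus m ⊛ oddPart onePlus m) (oddPart G) N ⟩
  ∏ (λ m → oddPart onePlus m ⊛ oddPart onePlus m) N ⊛ ∏ (oddPart G) N
    ≈⟨ ⊛-cong (∏-⊛ (oddPart onePlus) (oddPart onePlus) N) (≈-refl {∏ (oddPart G) N}) ⟩
  (∏ (oddPart onePlus) N ⊛ ∏ (oddPart onePlus) N) ⊛ ∏ (oddPart G) N
    ∎
  where
  open ≈-Reasoning
  G = λ m → geometric (2 * m)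
  factor-split : ∀ m → 1 ≤ m → oddPart overpartFactor m ≈ (oddPart onePlus m ⊛ oddPart onePlus m) ⊛ oddPart G m
  factor-split m 1≤m with isEven m
  ... | true  = ≈-sym (≈-trans (⊛-cong (⊛-identityˡ 1ₛ) (≈-refl {1ₛ})) (⊛-identityˡ 1ₛ))
  ... | false = ≈-trans (⊛-cong (≈-refl {onePlus m}) (geometric-split m 1≤m))
                        (≈-sym (⊛-assoc (onePlus m) (onePlus m) (G m)))

∏-evenPart-overpartFactor : ∀ N → ∏ (evenPart overpartFactor) (N + N) ≈ ∏ (λ k → onePlus (2 * k)) N ⊛ evenPartitions N
∏-evenPart-overpartFactor N = begin
  ∏ (evenPart overpartFactor) (N + N)
    ≈⟨ ∏-evenPart-double overpartFactor N ⟩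
  ∏ (λ k → onePlus (k + k) ⊛ geometric (k + k)) N
    ≈⟨ ∏-⊛ (λ k → onePlus (k + k)) (λ k → geometric (k + k)) N ⟩
  ∏ (λ k → onePlus (k + k)) N ⊛ ∏ (λ k → geometric (k + k)) N
    ≈⟨ ⊛-cong (∏-cong N (λ k → ≡⇒≈ (cong onePlus (sym (2*k≡k+k (suc k))))))
              (∏-cong N (λ k → ≡⇒≈ (cong geometric (sym (2*k≡k+k (suc k)))))) ⟩
  ∏ (λ k → onePlus (2 * k)) N ⊛ evenPartitions N
    ∎
  where open ≈-Reasoning

-- For odd m, L m = (1 + q^m)² / (1 - q^{2m}): the squared factors give θ times
-- ∏ 1/(1 - q^{2k}) by the triple product, and Euler's identity turns the
-- remaining factors into ∏ (1 + q^{2k}), which completes ∏_{m even} L m.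
oddFactors≈[]theta⊛evenFactors : ∀ N →
  ∏ (oddPart overpartFactor) N ≈[ suc N ] theta N ⊛ ∏ (evenPart overpartFactor) N
oddFactors≈[]theta⊛evenFactors N = begin
  ∏ (oddPart overpartFactor) N
    ≈⟨ ≈⇒≈[] _ (∏-oddPart-overpartFactor N) ⟩
  (∏ (oddPart onePlus) N ⊛ ∏ (oddPart onePlus) N) ⊛ ∏ (oddPart G) N
    ≈⟨ ⊛-cong[] (⊛-cong[] onePlus-part onePlus-part) geometric-part ⟩
  (∏odd onePlus N ⊛ ∏odd onePlus N) ⊛ E
    ≈⟨ ⊛-cong[] (≈[]-mono (s≤s (2*≥ N)) (∏odd-onePlus²≈[]theta⊛evenPartitions N)) (≈[]-refl {E}) ⟩
  (theta N ⊛ evenPartitions N) ⊛ E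
    ≈⟨ ≈⇒≈[] _ (solve 3 (λ t X P → (t :* X) :* P := t :* (P :* X)) ≈-refl (theta N) (evenPartitions N) E) ⟩
  theta N ⊛ (E ⊛ evenPartitions N)
    ≈⟨ ⊛-cong[] (≈[]-refl {theta N}) even-part ⟨
  theta N ⊛ ∏ (evenPart overpartFactor) N
    ∎
  where
  open ≈[]-Reasoning (suc N)
  2*≥ : ∀ m → m ≤ 2 * m
  2*≥ m = ℕₚ.m≤m+n m (m + 0)
  G = λ m → geometric (2 * m)
  E = ∏ (λ k → onePlus (2 * k)) N
  extend : ∀ F → (∀ m → N < m → F m ≈[ suc N ] 1ₛ) → ∏ F N ≈[ suc N ] ∏ F (N + N)
  extend F F≈1 = ≈[]-sym (∏-extend F (suc N) N F≈1 N)
  onePlus-part : ∏ (oddPart onePlus) N ≈[ suc N ] ∏odd onePlus N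
  onePlus-part = ≈[]-trans
    (extend (oddPart onePlus) (λ m N<m → oddPart≈[]1 onePlus m (≈[]-mono N<m (onePlus≈[]1 m))))
    (≈⇒≈[] _ (∏-oddPart-double onePlus N))
  geometric-part : ∏ (oddPart G) N ≈[ suc N ] E
  geometric-part = ≈[]-trans
    (extend (oddPart G) (λ m N<m → oddPart≈[]1 G m
      (≈[]-mono (ℕₚ.≤-trans N<m (2*≥ m)) (geometric≈[]1 (2 * m) (ℕₚ.≤-trans (s≤s z≤n) (ℕₚ.≤-trans N<m (2*≥ m)))))))
    (≈[]-mono (s≤s (ℕₚ.≤-trans (ℕₚ.m≤n+m N N) (ℕₚ.n≤1+n _))) (euler-odd-distinct N))
  even-part : ∏ (evenPart overpartFactor) N ≈[ suc N ] E ⊛ evenPartitions N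
  even-part = ≈[]-trans
    (extend (evenPart overpartFactor) (λ m N<m → evenPart≈[]1 overpartFactor m
      (≈[]-mono N<m (overpartFactor≈[]1 m (ℕₚ.≤-trans (s≤s z≤n) N<m)))))
    (≈⇒≈[] _ (∏-evenPart-overpartFactor N))

evenFactors : ℕ → ℤ[[q]]
evenFactors = ∏ (evenPart overpartFactor)

abar≡theta⊛evenFactors : ∀ r s T → + abar r s T ≡ (theta T ⊛^ s ⊛ evenFactors T ⊛^ (s + r)) T
abar≡theta⊛evenFactors r s T = begin
  + abar r s T                                          ≡⟨ abar≡coefficient r s T ⟩
  ∏ (coloured r s) T T                                  ≡⟨ ∏-coloured-split r s T T ⟩
  (∏ (oddPart overpartFactor) T ⊛^ s ⊛ E ⊛^ r) T
    ≡⟨ ⊛-cong[] (⊛^-cong[] s (oddFactors≈[]theta⊛evenFactors T)) (≈[]-refl {E ⊛^ r}) T (ℕₚ.n<1+n T) ⟩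
  ((theta T ⊛ E) ⊛^ s ⊛ E ⊛^ r) T                      ≡⟨ regroup T ⟩
  (theta T ⊛^ s ⊛ E ⊛^ (s + r)) T                      ∎
  where
  open ≡-Reasoning
  E = evenFactors T
  regroup : (theta T ⊛ E) ⊛^ s ⊛ E ⊛^ r ≈ theta T ⊛^ s ⊛ E ⊛^ (s + r)
  regroup = ≈-trans (⊛-cong (^-distrib-* (theta T) E s) (≈-refl {E ⊛^ r}))
            (≈-trans (⊛-assoc (theta T ⊛^ s) (E ⊛^ s) (E ⊛^ r))
                     (⊛-cong (≈-refl {theta T ⊛^ s}) (≈-sym (^-homo-* E s r))))

-- Series supported on even exponents
ParitySupported : Bool → ℤ[[q]] → Set
ParitySupported b f = ∀ n → isEven n ≡ not b → f n ≡ + 0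

EvenSeries : ℤ[[q]] → Set
EvenSeries = ParitySupported true

supported-tail : ∀ {b f} → ParitySupported b f → ParitySupported (not b) (tail f)
supported-tail {b} f-supp n n-parity =
  f-supp (suc n) (trans (isEven-suc n) (trans (cong not n-parity) (not-involutive (not b))))

supported-⊛ : ∀ a b {f g} → ParitySupported a f → ParitySupported b g → ParitySupported (a == b) (f ⊛ g)
supported-⊛ true  true  f-supp g-supp zero    ()
supported-⊛ true  false {f} f-supp g-supp zero _ = trans (cong (ℤ._*_ (f 0)) (g-supp 0 refl)) (ℤₚ.*-zeroʳ (f 0))
supported-⊛ false b {g = g} f-supp g-supp zero _ = cong (ℤ._* g 0) (f-supp 0 refl)
supported-⊛ a     b {f} {g} f-supp g-supp (suc n) n+1-parity =
  cong₂ ℤ._+_ (head-term a f-supp n+1-parity) (supported-⊛ (not a) b (supported-tail {a} f-supp) g-supp n n-parity)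
  where
  n-parity : isEven n ≡ not (not a == b)
  n-parity = begin
    isEven n                  ≡⟨ sym (not-involutive (isEven n)) ⟩
    not (not (isEven n))      ≡⟨ cong not (sym (isEven-suc n)) ⟩
    not (isEven (suc n))      ≡⟨ cong not n+1-parity ⟩
    not (not (a == b))        ≡⟨ flip a ⟩
    not (not a == b)          ∎
    where
    open ≡-Reasoning
    flip : ∀ a → not (not (a == b)) ≡ not (not a == b)
    flip true  = refl
    flip false = not-involutive (not b)
  head-term : ∀ a → ParitySupported a f → isEven (suc n) ≡ not (a == b) → f 0 ℤ.* g (suc n) ≡ + 0
  head-term true  _      parity = trans (cong (ℤ._*_ (f 0)) (g-supp (suc n) parity)) (ℤₚ.*-zeroʳ (f 0))
  head-term false f-supp _      = cong (ℤ._* g (suc n)) (f-supp 0 refl)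

supported-⊕ : ∀ b {f g} → ParitySupported b f → ParitySupported b g → ParitySupported b (f ⊕ g)
supported-⊕ b f-supp g-supp n parity = cong₂ ℤ._+_ (f-supp n parity) (g-supp n parity)

1ₛ-even : EvenSeries 1ₛ
1ₛ-even (suc n) _ = refl

⊛^-even : ∀ {f} k → EvenSeries f → EvenSeries (f ⊛^ k)
⊛^-even zero    f-even = 1ₛ-even
⊛^-even (suc k) f-even = supported-⊛ true true f-even (⊛^-even k f-even)

q^-supported : ∀ m → ParitySupported (isEven m) (q^ m)
q^-supported m n parity = q^-off m n (λ { refl → not-¬ refl parity })

geometric-even : ∀ m → 1 ≤ m → isEven m ≡ true → EvenSeries (geometric m)
geometric-even m 1≤m m-even = <-rec (λ n → isEven n ≡ false → geometric m n ≡ + 0) step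
  where
  step : ∀ n → (∀ {k} → k < n → isEven k ≡ false → geometric m k ≡ + 0) → isEven n ≡ false → geometric m n ≡ + 0
  step zero    _  ()
  step (suc n) ih odd = begin
    geometric m (suc n)                  ≡⟨ geometric-rec′ (suc n) ⟩
    + 0 ℤ.+ shift m (geometric m) (suc n) ≡⟨ ℤₚ.+-identityˡ _ ⟩
    shift m (geometric m) (suc n)         ≡⟨ shifted (ℕₚ.<-cmp (suc n) m) ⟩
    + 0                                   ∎
    where
    open ≡-Reasoning
    geometric-rec′ : ∀ k → geometric m k ≡ 1ₛ k ℤ.+ shift m (geometric m) k
    geometric-rec′ k = trans (embed-divMinus-rec m one 1≤m k) (cong (ℤ._+ shift m (geometric m) k) (embed-one k))
    shifted : Tri (suc n < m) (suc n ≡ m) (m < suc n) → shift m (geometric m) (suc n) ≡ + 0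
    shifted (tri< n<m _ _) = shift-below m (geometric m) n<m
    shifted (tri≈ _ refl _) = ⊥-elim (not-¬ m-even odd)
    shifted (tri> _ _ m<n) with ℕₚ.m≤n⇒∃[o]m+o≡n (ℕₚ.<⇒≤ m<n)
    ... | d , m+d≡n+1 =
      trans (cong (shift m (geometric m)) (sym m+d≡n+1)) (trans (shift-at m (geometric m) d) (ih d<n+1 d-odd))
      where
      d<n+1 : d < suc n
      d<n+1 = ℕₚ.<-≤-trans (ℕₚ.n<1+n d) (subst (suc d ≤_) m+d≡n+1 (ℕₚ.+-monoˡ-≤ d 1≤m))
      d-odd : isEven d ≡ false
      d-odd = begin
        isEven d              ≡⟨ cong (_== isEven d) (sym m-even) ⟩
        isEven m == isEven d  ≡⟨ isEven-+ m d ⟨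
        isEven (m + d)        ≡⟨ cong isEven m+d≡n+1 ⟩
        isEven (suc n)        ≡⟨ odd ⟩
        false                 ∎

overpartFactor-even : ∀ m → 1 ≤ m → isEven m ≡ true → EvenSeries (overpartFactor m)
overpartFactor-even m 1≤m m-even = supported-⊛ true true
  (supported-⊕ true 1ₛ-even (subst (λ b → ParitySupported b (q^ m)) m-even (q^-supported m)))
  (geometric-even m 1≤m m-even)

evenFactors-even : ∀ N → EvenSeries (evenFactors N)
evenFactors-even zero    = 1ₛ-even
evenFactors-even (suc N) = supported-⊛ true true (factor-even (isEven (suc N)) refl) (evenFactors-even N)
  where
  factor-even : ∀ b → isEven (suc N) ≡ b → EvenSeries (evenPart overpartFactor (suc N))
  factor-even true  parity rewrite parity = overpartFactor-even (suc N) (s≤s z≤n) parity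
  factor-even false parity rewrite parity = 1ₛ-even

-- Series of the form 1 + c·A
infix 4 _≈1+_∙_
_≈1+_∙_ : ℤ[[q]] → ℤ → ℤ[[q]] → Set
f ≈1+ c ∙ A = f ≈ 1ₛ ⊕ const c ⊛ A

circle : ℤ → ℤ[[q]] → ℤ[[q]] → ℤ[[q]]
circle c A B = A ⊕ B ⊕ const c ⊛ (A ⊛ B)

circlePow : ℤ → ℤ[[q]] → ℕ → ℤ[[q]]
circlePow c A zero    = 0ₛ
circlePow c A (suc i) = circle c A (circlePow c A i)

squaringDeviation : ℤ[[q]] → ℕ → ℤ[[q]]
squaringDeviation A zero    = A
squaringDeviation A (suc k) =
  squaringDeviation A k ⊕ const (+ (2 ^ k)) ⊛ (squaringDeviation A k ⊛ squaringDeviation A k)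

≈1+-cong : ∀ {f g c A} → f ≈ g → f ≈1+ c ∙ A → g ≈1+ c ∙ A
≈1+-cong f≈g f≈1+cA = ≈-trans (≈-sym f≈g) f≈1+cA

≈1+-1ₛ : ∀ c → 1ₛ ≈1+ c ∙ 0ₛ
≈1+-1ₛ c = solve 1 (λ k → con (+ 1) := con (+ 1) :+ k :* con (+ 0)) ≈-refl (const c)

≈1+-⊛ : ∀ {c f g A B} → f ≈1+ c ∙ A → g ≈1+ c ∙ B → f ⊛ g ≈1+ c ∙ circle c A B
≈1+-⊛ {c} {A = A} {B} f≈ g≈ = ≈-trans (⊛-cong f≈ g≈)
  (solve 3 (λ k a b → (con (+ 1) :+ k :* a) :* (con (+ 1) :+ k :* b) := con (+ 1) :+ k :* (a :+ b :+ k :* (a :* b)))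
           ≈-refl (const c) A B)

≈1+-⊛^ : ∀ {c f A} i → f ≈1+ c ∙ A → f ⊛^ i ≈1+ c ∙ circlePow c A i
≈1+-⊛^ {c} zero    f≈ = ≈1+-1ₛ c
≈1+-⊛^     (suc i) f≈ = ≈1+-⊛ f≈ (≈1+-⊛^ i f≈)

≈1+-square : ∀ {c f A} → f ≈1+ + 2 ℤ.* c ∙ A → f ⊛ f ≈1+ + 2 ℤ.* (+ 2 ℤ.* c) ∙ (A ⊕ const c ⊛ (A ⊛ A))
≈1+-square {c} {f} {A} f≈ = begin
  f ⊛ f
    ≈⟨ ⊛-cong f≈′ f≈′ ⟩
  (1ₛ ⊕ (const (+ 2) ⊛ const c) ⊛ A) ⊛ (1ₛ ⊕ (const (+ 2) ⊛ const c) ⊛ A)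
    ≈⟨ solve 2 (λ k a → (con (+ 1) :+ (con (+ 2) :* k) :* a) :* (con (+ 1) :+ (con (+ 2) :* k) :* a)
                      := con (+ 1) :+ (con (+ 2) :* (con (+ 2) :* k)) :* (a :+ k :* (a :* a))) ≈-refl (const c) A ⟩
  1ₛ ⊕ (const (+ 2) ⊛ (const (+ 2) ⊛ const c)) ⊛ (A ⊕ const c ⊛ (A ⊛ A))
    ≈⟨ ⊕-cong (≈-refl {1ₛ}) (⊛-cong 4c≈ (≈-refl {A ⊕ const c ⊛ (A ⊛ A)})) ⟨
  1ₛ ⊕ const (+ 2 ℤ.* (+ 2 ℤ.* c)) ⊛ (A ⊕ const c ⊛ (A ⊛ A))
    ∎
  where
  open ≈-Reasoning
  f≈′ : f ≈ 1ₛ ⊕ (const (+ 2) ⊛ const c) ⊛ A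
  f≈′ = ≈-trans f≈ (⊕-cong (≈-refl {1ₛ}) (⊛-cong (const-* (+ 2) c) (≈-refl {A})))
  4c≈ : const (+ 2 ℤ.* (+ 2 ℤ.* c)) ≈ const (+ 2) ⊛ (const (+ 2) ⊛ const c)
  4c≈ = ≈-trans (const-* (+ 2) (+ 2 ℤ.* c)) (⊛-cong (≈-refl {const (+ 2)}) (const-* (+ 2) c))

≈1+-⊛^2^ : ∀ {f A} k → f ≈1+ + 2 ∙ A → f ⊛^ (2 ^ k) ≈1+ + (2 ^ suc k) ∙ squaringDeviation A k
≈1+-⊛^2^ {f} zero    f≈ = ≈1+-cong (≈-sym (⊛-identityʳ f)) f≈
≈1+-⊛^2^ {f} {A} (suc k) f≈ = subst (λ c → f ⊛^ (2 ^ suc k) ≈1+ c ∙ squaringDeviation A (suc k)) (sym 2^[k+2]≡)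
  (≈1+-cong (≈-sym double-exponent)
    (≈1+-square (subst (λ c → f ⊛^ (2 ^ k) ≈1+ c ∙ squaringDeviation A k) (ℤₚ.pos-* 2 (2 ^ k)) (≈1+-⊛^2^ k f≈))))
  where
  2^[k+2]≡ : + (2 ^ suc (suc k)) ≡ + 2 ℤ.* (+ 2 ℤ.* + (2 ^ k))
  2^[k+2]≡ = trans (ℤₚ.pos-* 2 (2 ^ suc k)) (cong (ℤ._*_ (+ 2)) (ℤₚ.pos-* 2 (2 ^ k)))
  double-exponent : f ⊛^ (2 ^ suc k) ≈ f ⊛^ (2 ^ k) ⊛ f ⊛^ (2 ^ k)
  double-exponent = ≈-trans (≡⇒≈ (cong (f ⊛^_) (2*k≡k+k (2 ^ k)))) (^-homo-* f (2 ^ k) (2 ^ k))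

theta≈1+ : ∀ n → theta n ≈1+ + 2 ∙ squares n
theta≈1+ n = solve 1 (λ t → con (+ 1) :+ (t :+ t) := con (+ 1) :+ con (+ 2) :* t) ≈-refl (squares n)

overpartFactor≈1+ : ∀ m → 1 ≤ m → overpartFactor m ≈1+ + 2 ∙ (q^ m ⊛ geometric m)
overpartFactor≈1+ m 1≤m = begin
  (1ₛ ⊕ q^ m) ⊛ geometric m               ≈⟨ solve 2 (λ x g → (con (+ 1) :+ x) :* g := g :+ x :* g) ≈-refl (q^ m) (geometric m) ⟩
  geometric m ⊕ q^ m ⊛ geometric m        ≈⟨ ⊕-cong (geometric-rec m 1≤m) (≈-refl {q^ m ⊛ geometric m}) ⟩
  1ₛ ⊕ q^ m ⊛ geometric m ⊕ q^ m ⊛ geometric m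
    ≈⟨ solve 1 (λ x → con (+ 1) :+ x :+ x := con (+ 1) :+ con (+ 2) :* x) ≈-refl (q^ m ⊛ geometric m) ⟩
  1ₛ ⊕ const (+ 2) ⊛ (q^ m ⊛ geometric m) ∎
  where open ≈-Reasoning

evenFactors≈1+ : ∀ N → Σ ℤ[[q]] (λ B → evenFactors N ≈1+ + 2 ∙ B)
evenFactors≈1+ zero    = 0ₛ , ≈1+-1ₛ (+ 2)
evenFactors≈1+ (suc N) with isEven (suc N) | evenFactors≈1+ N
... | true  | B , E≈ = circle (+ 2) (q^ suc N ⊛ geometric (suc N)) B , ≈1+-⊛ (overpartFactor≈1+ (suc N) (s≤s z≤n)) E≈
... | false | B , E≈ = circle (+ 2) 0ₛ B , ≈1+-⊛ (≈1+-1ₛ (+ 2)) E≈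

≈1+-deviation-even : ∀ {f B} → f ≈1+ + 2 ∙ B → EvenSeries f → EvenSeries B
≈1+-deviation-even {f} {B} f≈ f-even n@(suc _) odd = ℤₚ.*-cancelˡ-≡ (+ 2) (B n) (+ 0) (begin
  + 2 ℤ.* B n                   ≡⟨ const-⊛ (+ 2) B n ⟨
  (const (+ 2) ⊛ B) n           ≡⟨ ℤₚ.+-identityˡ _ ⟨
  (1ₛ ⊕ const (+ 2) ⊛ B) n      ≡⟨ f≈ n ⟨
  f n                           ≡⟨ f-even n odd ⟩
  + 0                           ∎)
  where open ≡-Reasoning

2∣0 : + 2 ∣ℤ + 0
2∣0 = ℤ∣.divides (+ 0) refl

2∣circle : ∀ {c} A B n → + 2 ∣ℤ c → + 2 ∣ℤ A n → + 2 ∣ℤ B n → + 2 ∣ℤ circle c A B n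
2∣circle {c} A B n 2∣c 2∣A 2∣B = ∣m∣n⇒∣m+n (∣m∣n⇒∣m+n 2∣A 2∣B)
  (subst (+ 2 ∣ℤ_) (sym (const-⊛ c (A ⊛ B) n)) (∣m⇒∣m*n ((A ⊛ B) n) 2∣c))

2∣circlePow : ∀ {c} A n i → + 2 ∣ℤ c → + 2 ∣ℤ A n → + 2 ∣ℤ circlePow c A i n
2∣circlePow     A n zero    2∣c 2∣A = subst (+ 2 ∣ℤ_) (sym (const-0 n)) 2∣0
2∣circlePow {c} A n (suc i) 2∣c 2∣A = 2∣circle A (circlePow c A i) n 2∣c 2∣A (2∣circlePow A n i 2∣c 2∣A)

-- A² = Aₑ² + 2 Aₑ Aₒ + Aₒ² for the even and odd parts Aₑ, Aₒ of A, and both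
-- Aₑ² and Aₒ² vanish at odd exponents.
2∣square-at-odd : ∀ A n → isEven n ≡ false → + 2 ∣ℤ (A ⊛ A) n
2∣square-at-odd A n odd = subst (+ 2 ∣ℤ_) (sym (expand n))
  (∣m∣n⇒∣m+n (∣m∣n⇒∣m+n (subst (+ 2 ∣ℤ_) (sym (supported-⊛ true true Aₑ-even Aₑ-even n odd)) 2∣0)
                        (subst (+ 2 ∣ℤ_) (sym (const-⊛ (+ 2) (Aₑ ⊛ Aₒ) n))
                               (∣m⇒∣m*n ((Aₑ ⊛ Aₒ) n) (ℤ∣.divides (+ 1) refl))))
             (subst (+ 2 ∣ℤ_) (sym (supported-⊛ false false Aₒ-odd Aₒ-odd n odd)) 2∣0))
  where
  Aₑ Aₒ : ℤ[[q]]
  Aₑ k = if isEven k then A k else + 0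
  Aₒ k = if isEven k then + 0 else A k
  Aₑ-even : ParitySupported true Aₑ
  Aₑ-even k parity rewrite parity = refl
  Aₒ-odd : ParitySupported false Aₒ
  Aₒ-odd k parity rewrite parity = refl
  split : A ≈ Aₑ ⊕ Aₒ
  split k with isEven k
  ... | true  = sym (ℤₚ.+-identityʳ (A k))
  ... | false = sym (ℤₚ.+-identityˡ (A k))
  expand : A ⊛ A ≈ Aₑ ⊛ Aₑ ⊕ const (+ 2) ⊛ (Aₑ ⊛ Aₒ) ⊕ Aₒ ⊛ Aₒ
  expand = ≈-trans (⊛-cong split split)
    (solve 2 (λ a b → (a :+ b) :* (a :+ b) := a :* a :+ con (+ 2) :* (a :* b) :+ b :* b) ≈-refl Aₑ Aₒ)

2∣squaringDeviation : ∀ A n k → isEven n ≡ false → + 2 ∣ℤ A n → + 2 ∣ℤ squaringDeviation A k n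
2∣squaringDeviation A n zero    odd 2∣A = 2∣A
2∣squaringDeviation A n (suc k) odd 2∣A = ∣m∣n⇒∣m+n (2∣squaringDeviation A n k odd 2∣A)
  (subst (+ 2 ∣ℤ_) (sym (const-⊛ (+ (2 ^ k)) (Z ⊛ Z) n)) (∣n⇒∣m*n (+ (2 ^ k)) (2∣square-at-odd Z n odd)))
  where
  Z = squaringDeviation A k

NonSquare : ℕ → Set
NonSquare n = ∀ j → j * j ≢ n

nonSquare-by-residues : ∀ d .{{_ : NonZero d}} a → a < d →
  (∀ r → r < d → (r * r) % d ≢ a) → ∀ n → NonSquare (a + n * d)
nonSquare-by-residues d a a<d residues n j j²≡ = residues (j % d) (m%n<n j d) (begin
  ((j % d) * (j % d)) % d    ≡⟨ %-distribˡ-* j j d ⟨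
  (j * j) % d                ≡⟨ cong (_% d) j²≡ ⟩
  (a + n * d) % d            ≡⟨ [m+kn]%n≡m%n a n d ⟩
  a % d                      ≡⟨ m<n⇒m%n≡m a<d ⟩
  a                          ∎)
  where open ≡-Reasoning

square-residue-mod-4 : ∀ r → r < 4 → (r * r) % 4 < 2
square-residue-mod-4 0 _ = s≤s z≤n
square-residue-mod-4 1 _ = s≤s (s≤s z≤n)
square-residue-mod-4 2 _ = s≤s z≤n
square-residue-mod-4 3 _ = s≤s (s≤s z≤n)
square-residue-mod-4 (suc (suc (suc (suc r)))) (s≤s (s≤s (s≤s (s≤s ()))))

nonSquare-mod-4 : ∀ a n → 2 ≤ a → a < 4 → NonSquare (a + n * 4)
nonSquare-mod-4 a n 2≤a a<4 = nonSquare-by-residues 4 a a<4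
  (λ r r<4 r²≡a → ℕₚ.<⇒≱ (subst (_< 2) r²≡a (square-residue-mod-4 r r<4)) 2≤a) n

nonSquare-5-mod-8 : ∀ n → NonSquare (5 + n * 8)
nonSquare-5-mod-8 = nonSquare-by-residues 8 5 (s≤s (s≤s (s≤s (s≤s (s≤s (s≤s z≤n)))))) residues
  where
  residues : ∀ r → r < 8 → (r * r) % 8 ≢ 5
  residues 0 _ ()
  residues 1 _ ()
  residues 2 _ ()
  residues 3 _ ()
  residues 4 _ ()
  residues 5 _ ()
  residues 6 _ ()
  residues 7 _ ()
  residues (suc (suc (suc (suc (suc (suc (suc (suc r)))))))) (s≤s (s≤s (s≤s (s≤s (s≤s (s≤s (s≤s (s≤s ()))))))))

nonSquare-4n+2 : ∀ n → NonSquare (4 * n + 2)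
nonSquare-4n+2 n = subst NonSquare (rearrange n) (nonSquare-mod-4 2 n ℕₚ.≤-refl (s≤s (s≤s (s≤s z≤n))))
  where
  rearrange : ∀ n → 2 + n * 4 ≡ 4 * n + 2
  rearrange = solve-ℕ

nonSquare-4n+3 : ∀ n → NonSquare (4 * n + 3)
nonSquare-4n+3 n = subst NonSquare (rearrange n) (nonSquare-mod-4 3 n (ℕₚ.n≤1+n 2) ℕₚ.≤-refl)
  where
  rearrange : ∀ n → 3 + n * 4 ≡ 4 * n + 3
  rearrange = solve-ℕ

nonSquare-8n+5 : ∀ n → NonSquare (8 * n + 5)
nonSquare-8n+5 n = subst NonSquare (rearrange n) (nonSquare-5-mod-8 n)
  where
  rearrange : ∀ n → 5 + n * 8 ≡ 8 * n + 5
  rearrange = solve-ℕ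

squares-nonSquare : ∀ K {n} → NonSquare n → squares K n ≡ + 0
squares-nonSquare zero    {n} _          = const-0 n
squares-nonSquare (suc K) {n} non-square =
  cong₂ ℤ._+_ (squares-nonSquare K non-square) (q^-off (suc K * suc K) n (non-square (suc K)))

theta-nonSquare : ∀ K {n} → NonSquare n → theta K n ≡ + 0
theta-nonSquare K {zero}  non-square = ⊥-elim (non-square 0 refl)
theta-nonSquare K {suc n} non-square =
  cong (λ t → + 0 ℤ.+ (t ℤ.+ t)) (squares-nonSquare K non-square)

≈1+-coefficient-odd : ∀ {c f A} H T → f ≈1+ c ∙ A → EvenSeries H → isEven T ≡ false →
  (f ⊛ H) T ≡ c ℤ.* (A ⊛ H) T
≈1+-coefficient-odd {c} {f} {A} H T f≈ H-even odd = begin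
  (f ⊛ H) T                           ≡⟨ ⊛-cong f≈ (≈-refl {H}) T ⟩
  ((1ₛ ⊕ const c ⊛ A) ⊛ H) T
    ≡⟨ solve 3 (λ k a h → (con (+ 1) :+ k :* a) :* h := h :+ k :* (a :* h)) ≈-refl (const c) A H T ⟩
  H T ℤ.+ (const c ⊛ (A ⊛ H)) T       ≡⟨ cong₂ ℤ._+_ (H-even T odd) (const-⊛ c (A ⊛ H) T) ⟩
  + 0 ℤ.+ c ℤ.* (A ⊛ H) T             ≡⟨ ℤₚ.+-identityˡ _ ⟩
  c ℤ.* (A ⊛ H) T                     ∎
  where open ≡-Reasoning

≈1+-coefficient-suc : ∀ {c f A} T → f ≈1+ c ∙ A → f (suc T) ≡ c ℤ.* A (suc T)
≈1+-coefficient-suc {c} {f} {A} T f≈ =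
  trans (f≈ (suc T)) (trans (ℤₚ.+-identityˡ _) (const-⊛ c A (suc T)))

ℤ-multiple⇒∣ : ∀ {a} c X → + a ≡ + c ℤ.* X → c ∣ a
ℤ-multiple⇒∣ c X a≡cX = ∣⇒∣ᵤ (ℤ∣.divides X (trans a≡cX (ℤₚ.*-comm (+ c) X)))

ℤ-even-multiple⇒∣ : ∀ {a} c X → + a ≡ + c ℤ.* X → + 2 ∣ℤ X → c * 2 ∣ a
ℤ-even-multiple⇒∣ {a} c X a≡cX 2∣X = ∣⇒∣ᵤ (subst₂ _∣ℤ_ (sym (ℤₚ.pos-* c 2)) (sym a≡cX) (*-monoʳ-∣ (+ c) 2∣X))

2^[k+1]≡ : ∀ k → 2 ^ suc k ≡ 2 ^ (k + 1)
2^[k+1]≡ k = cong (2 ^_) (ℕₚ.+-comm 1 k)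

2^[k+2]≡ : ∀ k → 2 ^ suc k * 2 ≡ 2 ^ (k + 2)
2^[k+2]≡ k = trans (ℕₚ.*-comm (2 ^ suc k) 2) (cong (2 ^_) (ℕₚ.+-comm 2 k))

abar-congruence-odd-index : ∀ r k i T → isEven T ≡ false → 2 ^ (k + 1) ∣ abar r (2 ^ k * suc (2 * i)) T
abar-congruence-odd-index r k i T odd = subst (_∣ abar r s T) (2^[k+1]≡ k) (ℤ-multiple⇒∣ (2 ^ suc k) _ (begin
  + abar r s T                         ≡⟨ abar≡theta⊛evenFactors r s T ⟩
  (theta T ⊛^ s ⊛ E ⊛^ (s + r)) T      ≡⟨ ≈1+-coefficient-odd (E ⊛^ (s + r)) T θ^s≈ (⊛^-even (s + r) (evenFactors-even T)) odd ⟩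
  + (2 ^ suc k) ℤ.* (_ ⊛ E ⊛^ (s + r)) T ∎))
  where
  open ≡-Reasoning
  s = 2 ^ k * suc (2 * i)
  E = evenFactors T
  θ^s≈ : theta T ⊛^ s ≈1+ + (2 ^ suc k) ∙ circlePow (+ (2 ^ suc k)) (squaringDeviation (squares T) k) (suc (2 * i))
  θ^s≈ = ≈1+-cong (^-assocʳ (theta T) (2 ^ k) (suc (2 * i))) (≈1+-⊛^ (suc (2 * i)) (≈1+-⊛^2^ k (theta≈1+ T)))

mixedPower≈1+ : ∀ T k i m → Σ ℤ[[q]] λ M →
    theta T ⊛^ (2 ^ k * i) ⊛ evenFactors T ⊛^ (2 ^ k * m) ≈1+ + (2 ^ suc k) ∙ M
  × (isEven T ≡ false → NonSquare T → + 2 ∣ℤ M T)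
mixedPower≈1+ T k i m with evenFactors≈1+ T
... | B , E≈ = circle c (circlePow c Zθ i) (circlePow c Z m) , form , M-even
  where
  c  = + (2 ^ suc k)
  Zθ = squaringDeviation (squares T) k
  Z  = squaringDeviation B k
  power≈ : ∀ {f A} j → f ≈1+ + 2 ∙ A → f ⊛^ (2 ^ k * j) ≈1+ c ∙ circlePow c (squaringDeviation A k) j
  power≈ {f} j f≈ = ≈1+-cong (^-assocʳ f (2 ^ k) j) (≈1+-⊛^ j (≈1+-⊛^2^ k f≈))
  form = ≈1+-⊛ (power≈ i (theta≈1+ T)) (power≈ m E≈)
  2∣c : + 2 ∣ℤ c
  2∣c = ℤ∣.divides (+ (2 ^ k)) (trans (ℤₚ.pos-* 2 (2 ^ k)) (ℤₚ.*-comm (+ 2) (+ (2 ^ k))))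
  M-even : isEven T ≡ false → NonSquare T → + 2 ∣ℤ circle c (circlePow c Zθ i) (circlePow c Z m) T
  M-even odd non-square = 2∣circle (circlePow c Zθ i) (circlePow c Z m) T 2∣c
    (2∣circlePow Zθ T i 2∣c (2∣squaringDeviation (squares T) T k odd
      (subst (+ 2 ∣ℤ_) (sym (squares-nonSquare T non-square)) 2∣0)))
    (2∣circlePow Z T m 2∣c (2∣squaringDeviation B T k odd
      (subst (+ 2 ∣ℤ_) (sym (≈1+-deviation-even E≈ (evenFactors-even T) T odd)) 2∣0)))

abar-congruence-2^k∣s : ∀ k r s T → 2 ^ k ∣ s → 2 ^ k ∣ s + r → 1 ≤ T →
    2 ^ (k + 1) ∣ abar r s T
  × (isEven T ≡ false → NonSquare T → 2 ^ (k + 2) ∣ abar r s T)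
abar-congruence-2^k∣s k r s T@(suc T′) (divides i s≡) (divides m s+r≡) _ with mixedPower≈1+ T k i m
... | M , form , M-even =
    subst (_∣ abar r s T) (2^[k+1]≡ k) (ℤ-multiple⇒∣ (2 ^ suc k) (M T) value)
  , λ odd non-square → subst (_∣ abar r s T) (2^[k+2]≡ k)
                          (ℤ-even-multiple⇒∣ (2 ^ suc k) (M T) value (M-even odd non-square))
  where
  open ≡-Reasoning
  E = evenFactors T
  value : + abar r s T ≡ + (2 ^ suc k) ℤ.* M T
  value = begin
    + abar r s T                                         ≡⟨ abar≡theta⊛evenFactors r s T ⟩
    (theta T ⊛^ s ⊛ E ⊛^ (s + r)) T                      ≡⟨ cong₂ (λ a b → (theta T ⊛^ a ⊛ E ⊛^ b) T)
                                                              (trans s≡ (ℕₚ.*-comm i (2 ^ k))) (trans s+r≡ (ℕₚ.*-comm m (2 ^ k))) ⟩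
    (theta T ⊛^ (2 ^ k * i) ⊛ E ⊛^ (2 ^ k * m)) T        ≡⟨ ≈1+-coefficient-suc T′ form ⟩
    + (2 ^ suc k) ℤ.* M T                                ∎

theta⊛≈1+ : ∀ K {c f M} → f ≈1+ c ∙ M →
  theta K ⊛ f ≈ theta K ⊕ const c ⊛ (M ⊕ const (+ 2) ⊛ (squares K ⊛ M))
theta⊛≈1+ K {c} {f} {M} f≈ = ≈-trans (⊛-cong (≈-refl {theta K}) f≈)
  (solve 3 (λ k t m → (con (+ 1) :+ (t :+ t)) :* (con (+ 1) :+ k :* m)
                   := (con (+ 1) :+ (t :+ t)) :+ k :* (m :+ con (+ 2) :* (t :* m))) ≈-refl (const c) (squares K) M)

abar-congruence-2^k∣s∸1 : ∀ k r s T → 1 ≤ s → 2 ^ k ∣ s ∸ 1 → 2 ^ k ∣ s + r → NonSquare T →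
    2 ^ (k + 1) ∣ abar r s T
  × (isEven T ≡ false → 2 ^ (k + 2) ∣ abar r s T)
abar-congruence-2^k∣s∸1 k r s@(suc s′) T _ (divides i s′≡) (divides m s+r≡) non-square with mixedPower≈1+ T k i m
... | M , form , M-even =
    subst (_∣ abar r s T) (2^[k+1]≡ k) (ℤ-multiple⇒∣ (2 ^ suc k) X value)
  , λ odd → subst (_∣ abar r s T) (2^[k+2]≡ k) (ℤ-even-multiple⇒∣ (2 ^ suc k) X value (X-even odd))
  where
  open ≡-Reasoning
  c = + (2 ^ suc k)
  E = evenFactors T
  X = (M ⊕ const (+ 2) ⊛ (squares T ⊛ M)) T
  X-even : isEven T ≡ false → + 2 ∣ℤ X
  X-even odd = ∣m∣n⇒∣m+n (M-even odd non-square)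
    (subst (+ 2 ∣ℤ_) (sym (const-⊛ (+ 2) (squares T ⊛ M) T)) (∣m⇒∣m*n _ (ℤ∣.divides (+ 1) refl)))
  value : + abar r s T ≡ c ℤ.* X
  value = begin
    + abar r s T
      ≡⟨ abar≡theta⊛evenFactors r s T ⟩
    (theta T ⊛^ s ⊛ E ⊛^ (s + r)) T
      ≡⟨ ⊛-assoc (theta T) (theta T ⊛^ s′) (E ⊛^ (s + r)) T ⟩
    (theta T ⊛ (theta T ⊛^ s′ ⊛ E ⊛^ (s + r))) T
      ≡⟨ cong₂ (λ a b → (theta T ⊛ (theta T ⊛^ a ⊛ E ⊛^ b)) T)
               (trans s′≡ (ℕₚ.*-comm i (2 ^ k))) (trans s+r≡ (ℕₚ.*-comm m (2 ^ k))) ⟩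
    (theta T ⊛ (theta T ⊛^ (2 ^ k * i) ⊛ E ⊛^ (2 ^ k * m))) T
      ≡⟨ theta⊛≈1+ T form T ⟩
    theta T T ℤ.+ (const c ⊛ (M ⊕ const (+ 2) ⊛ (squares T ⊛ M))) T
      ≡⟨ cong₂ ℤ._+_ (theta-nonSquare T non-square) (const-⊛ c _ T) ⟩
    + 0 ℤ.+ c ℤ.* X
      ≡⟨ ℤₚ.+-identityˡ _ ⟩
    c ℤ.* X
      ∎

2^[k+1]*m+2^k≡ : ∀ k m → 2 ^ (k + 1) * m + 2 ^ k ≡ 2 ^ k * suc (2 * m)
2^[k+1]*m+2^k≡ k m = begin
  2 ^ (k + 1) * m + 2 ^ k    ≡⟨ cong (λ x → x * m + 2 ^ k) (ℕₚ.^-distribˡ-+-* 2 k 1) ⟩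
  2 ^ k * 2 * m + 2 ^ k      ≡⟨ rearrange (2 ^ k) m ⟩
  2 ^ k * suc (2 * m)        ∎
  where
  open ≡-Reasoning
  rearrange : ∀ P j → P * 2 * j + P ≡ P * suc (2 * j)
  rearrange = solve-ℕ

colour-sum-C : ∀ k i j → (2 ^ k * i + 1) + (2 ^ (k + 1) * j + 2 ^ k ∸ 1) ≡ (i + suc (2 * j)) * 2 ^ k
colour-sum-C k i j = begin
  (2 ^ k * i + 1) + (2 ^ (k + 1) * j + 2 ^ k ∸ 1) ≡⟨ cong (λ x → (2 ^ k * i + 1) + (x ∸ 1)) (2^[k+1]*m+2^k≡ k j) ⟩
  (2 ^ k * i + 1) + (2 ^ k * suc (2 * j) ∸ 1)     ≡⟨ positive (2 ^ k) (ℕₚ.m^n>0 2 k) ⟩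
  (i + suc (2 * j)) * 2 ^ k                       ∎
  where
  open ≡-Reasoning
  rearrange : ∀ p i j → (suc p * i + 1) + (2 * j + p * suc (2 * j)) ≡ (i + suc (2 * j)) * suc p
  rearrange = solve-ℕ
  positive : ∀ P → 1 ≤ P → (P * i + 1) + (P * suc (2 * j) ∸ 1) ≡ (i + suc (2 * j)) * P
  positive (suc p) _ = rearrange p i j

colour-sum-D : ∀ k i j → 2 ^ k * i + (2 ^ (k + 1) * j + 2 ^ k) ≡ (i + suc (2 * j)) * 2 ^ k
colour-sum-D k i j = trans (cong (_+_ (2 ^ k * i)) (2^[k+1]*m+2^k≡ k j)) (rearrange (2 ^ k) i j)
  where
  rearrange : ∀ P i j → P * i + P * suc (2 * j) ≡ (i + suc (2 * j)) * P
  rearrange = solve-ℕ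

theorem1p6 : (n r k i j : ℕ) → 1 ≤ r → 1 ≤ k → 1 ≤ i → 1 ≤ j →
      (2 ^ (k + 1) ∣ abar r (2 ^ k) (2 * n + 1))
    × (2 ^ k ∣ abar r (2 ^ k * i + 2 ^ (k ∸ 1)) (2 * n + 1))
    × (2 ^ (k + 1) ∣ abar (2 ^ (k + 1) * j + 2 ^ k ∸ 1) (2 ^ k * i + 1) (4 * n + 2))
    × (2 ^ (k + 1) ∣ abar (2 ^ (k + 1) * j + 2 ^ k) (2 ^ k * i) (4 * n + 2))
    × (2 ^ (k + 2) ∣ abar (2 ^ (k + 1) * j + 2 ^ k ∸ 1) (2 ^ k * i + 1) (4 * n + 3))
    × (2 ^ (k + 2) ∣ abar (2 ^ (k + 1) * j + 2 ^ k) (2 ^ k * i) (4 * n + 3))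
    × (2 ^ (k + 1) ∣ abar (2 ^ (k + 1) * j + 2 ^ k) (2 ^ k * i) (8 * n + 4))
    × (2 ^ (k + 2) ∣ abar (2 ^ (k + 1) * j + 2 ^ k ∸ 1) (2 ^ k * i + 1) (8 * n + 5))
theorem1p6 n r k@(suc k′) i j _ (s≤s z≤n) _ _ =
    subst (λ s → 2 ^ (k + 1) ∣ abar r s (2 * n + 1)) (ℕₚ.*-identityʳ (2 ^ k))
          (abar-congruence-odd-index r k 0 (2 * n + 1) (odd-2n+1 n))
  , subst₂ (λ e s → 2 ^ e ∣ abar r s (2 * n + 1)) (ℕₚ.+-comm k′ 1)
           (trans (sym (2^[k+1]*m+2^k≡ k′ i)) (cong (λ e → 2 ^ e * i + 2 ^ k′) (ℕₚ.+-comm k′ 1)))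
           (abar-congruence-odd-index r k′ i (2 * n + 1) (odd-2n+1 n))
  , proj₁ (family₁ (4 * n + 2) (nonSquare-4n+2 n))
  , proj₁ (family₀ (4 * n) 1)
  , proj₂ (family₁ (4 * n + 3) (nonSquare-4n+3 n)) (odd-4n+3 n)
  , proj₂ (family₀ (4 * n) 2) (odd-4n+3 n) (nonSquare-4n+3 n)
  , proj₁ (family₀ (8 * n) 3)
  , proj₂ (family₁ (8 * n + 5) (nonSquare-8n+5 n)) (odd-8n+5 n)
  where
  r₁ = 2 ^ (k + 1) * j + 2 ^ k ∸ 1
  s₁ = 2 ^ k * i + 1
  r₀ = 2 ^ (k + 1) * j + 2 ^ k
  s₀ = 2 ^ k * i
  family₁ : ∀ T → NonSquare T → 2 ^ (k + 1) ∣ abar r₁ s₁ T × (isEven T ≡ false → 2 ^ (k + 2) ∣ abar r₁ s₁ T)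
  family₁ T = abar-congruence-2^k∣s∸1 k r₁ s₁ T (ℕₚ.m≤n+m 1 s₀)
          (divides i (trans (ℕₚ.m+n∸n≡m s₀ 1) (ℕₚ.*-comm (2 ^ k) i))) (divides (i + suc (2 * j)) (colour-sum-C k i j))
  family₀ : ∀ m a → let T = m + suc a in
      2 ^ (k + 1) ∣ abar r₀ s₀ T × (isEven T ≡ false → NonSquare T → 2 ^ (k + 2) ∣ abar r₀ s₀ T)
  family₀ m a = abar-congruence-2^k∣s k r₀ s₀ (m + suc a) (divides i (ℕₚ.*-comm (2 ^ k) i))
    (divides (i + suc (2 * j)) (colour-sum-D k i j)) (ℕₚ.≤-trans (s≤s z≤n) (ℕₚ.m≤n+m (suc a) m))
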